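{- Let $u_1,u_2,u_3,u_4,\alpha,\beta$ be indeterminates, and define $g_k=k(u_3+u_4)+\alpha\beta$ for $k\ge0$ and $b_k=k(\beta-1+k)u_1u_2$ for $k\ge1$. Define $\mu_{n,k}$ by $\mu_{0,0}=1$, $\mu_{n,k}=0$ if $k\notin[0,n]$, and $\mu_{n,k}=\mu_{n-1,k-1}+g_k\mu_{n-1,k}+b_{k+1}\mu_{n-1,k+1}$ for $n\ge k\ge0$, $n\ge1$. Then for all $0\le k\le n$, \[ \mu_{n,k}=\sum_{G\in {\rm LD}_{n,k}}u_1^{{\rm pk}(G)-k}u_2^{{\rm val}(G)}u_3^{{\rm da}(G)}u_4^{{\rm dd}(G)}\alpha^{{\rm fp}(G)}\beta^{{\rm cyc}(G)}. \]
   Context: A Laguerre digraph on $[n]=\{1,\dots,n\}$ is a directed graph with vertex set $[n]$ (loops allowed) in which every vertex has in-degree $0$ or $1$ and out-degree $0$ or $1$; its connected components are directed cycles (including loops) and directed paths (including isolated vertices). ${\rm LD}_{n,k}$ is the set of Laguerre digraphs on $[n]$ with exactly $k$ path components. For $G\in{\rm LD}_{n,k}$, extend $G$ to a digraph on $[n]\cup\{0\}$ by adding an edge $0\to i$ for each vertex $i$ of in-degree $0$ and an edge $i\to 0$ for each vertex $i$ of out-degree $0$; then each $i\in[n]$ has a unique predecessor $p(i)\in[n]\cup\{0\}$ and successor $s(i)\in[n]\cup\{0\}$. Vertex $i$ is a peak if $p(i)<i>s(i)$, a valley if $p(i)>i<s(i)$, a double ascent if $p(i)<i<s(i)$, a double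 descent if $p(i)>i>s(i)$, a fixed point if $p(i)=i=s(i)$. ${\rm pk}(G),{\rm val}(G),{\rm da}(G),{\rm dd}(G),{\rm fp}(G)$ are the numbers of such vertices, and ${\rm cyc}(G)$ is the number of cycle components of $G$ (loops included). -}

module Defs where

open import Level using (Level)
open import Data.Nat using (ℕ; zero; suc; _∸_; _<ᵇ_; _≡ᵇ_; _≤ᵇ_)
open import Data.Fin using (Fin; toℕ)
open import Data.Maybe using (Maybe; just; nothing)
open import Data.Vec using (Vec; []; _∷_; lookup)
open import Data.List using (List; []; _∷_; map; concatMap; allFin; upTo)
open import Data.Bool using (Bool; true; false; _∧_; _∨_; not; if_then_else_)
open import Algebra.Bundles using (CommutativeRing)

-- Vertex i ∈ [n] is represented by (i' : Fin n) with i = toℕ i' + 1.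
-- A digraph on [n] with every out-degree ≤ 1 is the same as its
-- successor map  Fin n → Maybe (Fin n)  (nothing = out-degree 0),
-- stored as a vector.  It is a Laguerre digraph iff additionally every
-- in-degree is ≤ 1, i.e. the successor map is injective where defined.

Digraph : ℕ → Set
Digraph n = Vec (Maybe (Fin n)) n

allVecs : {A : Set} → List A → (m : ℕ) → List (Vec A m)
allVecs xs zero = [] ∷ []
allVecs xs (suc m) = concatMap (λ x → map (x ∷_) (allVecs xs m)) xs

allDigraphs : (n : ℕ) → List (Digraph n)
allDigraphs n = allVecs (nothing ∷ map just (allFin n)) n

allB : {A : Set} → List A → (A → Bool) → Bool
allB [] p = true
allB (x ∷ xs) p = p x ∧ allB xs p

anyB : {A : Set} → List A → (A → Bool) → Bool
anyB [] p = false
anyB (x ∷ xs) p = p x ∨ anyB xs p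

count : {A : Set} → List A → (A → Bool) → ℕ
count [] p = 0
count (x ∷ xs) p = if p x then suc (count xs p) else count xs p

eqF : {n : ℕ} → Fin n → Fin n → Bool
eqF i j = toℕ i ≡ᵇ toℕ j

sameTarget : {n : ℕ} → Maybe (Fin n) → Maybe (Fin n) → Bool
sameTarget (just x) (just y) = eqF x y
sameTarget _ _ = false

isNothing : {A : Set} → Maybe A → Bool
isNothing nothing = true
isNothing (just _) = false

isLaguerre : {n : ℕ} → Digraph n → Bool
isLaguerre {n} G =
  allB (allFin n) λ i → allB (allFin n) λ j →
    eqF i j ∨ not (sameTarget (lookup G i) (lookup G j))

-- number of path components = number of vertices of out-degree 0
-- (every path component has exactly one terminal vertex; cycles none)
paths : {n : ℕ} → Digraph n → ℕ
paths {n} G = count (allFin n) λ i → isNothing (lookup G i)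

lab : {n : ℕ} → Maybe (Fin n) → ℕ
lab nothing = 0
lab (just j) = suc (toℕ j)

vlab : {n : ℕ} → Fin n → ℕ
vlab i = suc (toℕ i)

-- successor s(i) (0 if out-degree 0)
succV : {n : ℕ} → Digraph n → Fin n → ℕ
succV G i = lab (lookup G i)

firstPred : {n : ℕ} → Digraph n → Fin n → List (Fin n) → ℕ
firstPred G i [] = 0
firstPred G i (j ∷ js) =
  if sameTarget (lookup G j) (just i) then vlab j else firstPred G i js

-- predecessor p(i) (0 if in-degree 0)
predV : {n : ℕ} → Digraph n → Fin n → ℕ
predV {n} G i = firstPred G i (allFin n)

isPk isVal isDa isDd isFp : {n : ℕ} → Digraph n → Fin n → Bool
isPk G i = (predV G i <ᵇ vlab i) ∧ (succV G i <ᵇ vlab i)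
isVal G i = (vlab i <ᵇ predV G i) ∧ (vlab i <ᵇ succV G i)
isDa G i = (predV G i <ᵇ vlab i) ∧ (vlab i <ᵇ succV G i)
isDd G i = (vlab i <ᵇ predV G i) ∧ (succV G i <ᵇ vlab i)
isFp G i = (predV G i ≡ᵇ vlab i) ∧ (succV G i ≡ᵇ vlab i)

pk val da dd fp : {n : ℕ} → Digraph n → ℕ
pk {n} G = count (allFin n) (isPk G)
val {n} G = count (allFin n) (isVal G)
da {n} G = count (allFin n) (isDa G)
dd {n} G = count (allFin n) (isDd G)
fp {n} G = count (allFin n) (isFp G)

iter : {n : ℕ} → Digraph n → ℕ → Fin n → Maybe (Fin n)
iter G zero i = just i
iter G (suc m) i with lookup G i
... | nothing = nothing
... | just j = iter G m j

onCycle : {n : ℕ} → Digraph n → Fin n → Bool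
onCycle {n} G i = anyB (map suc (upTo n)) λ m → sameTarget (iter G m i) (just i)

leTarget : {n : ℕ} → Fin n → Maybe (Fin n) → Bool
leTarget i nothing = true
leTarget i (just j) = toℕ i ≤ᵇ toℕ j

cycleMin : {n : ℕ} → Digraph n → Fin n → Bool
cycleMin {n} G i = onCycle G i ∧ allB (upTo n) λ m → leTarget i (iter G m i)

-- number of cycle components (one smallest vertex per cycle)
cyc : {n : ℕ} → Digraph n → ℕ
cyc {n} G = count (allFin n) (cycleMin G)

inLD : (n k : ℕ) → Digraph n → Bool
inLD n k G = isLaguerre G ∧ (paths G ≡ᵇ k)

-- Ring side: the indeterminates are arbitrary elements of an arbitrary
-- commutative ring (equivalent to a polynomial identity in ℤ[u,α,β]).

module Poly {c ℓ : Level} (R : CommutativeRing c ℓ) where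
  open CommutativeRing R

  pow : Carrier → ℕ → Carrier
  pow x zero = 1#
  pow x (suc m) = x * pow x m

  nat : ℕ → Carrier
  nat zero = 0#
  nat (suc m) = 1# + nat m

  sumR : List Carrier → Carrier
  sumR [] = 0#
  sumR (x ∷ xs) = x + sumR xs

  module _ (u₁ u₂ u₃ u₄ α β : Carrier) where

    g : ℕ → Carrier
    g k = nat k * (u₃ + u₄) + α * β

    b : ℕ → Carrier
    b k = nat k * ((β + (- 1#)) + nat k) * u₁ * u₂

    μ : ℕ → ℕ → Carrier
    μ zero zero = 1#
    μ zero (suc k) = 0#
    μ (suc n) zero = g 0 * μ n 0 + b 1 * μ n 1
    μ (suc n) (suc k) = μ n k + g (suc k) * μ n (suc k) + b (suc (suc k)) * μ n (suc (suc k))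

    weight : (k : ℕ) {n : ℕ} → Digraph n → Carrier
    weight k G = pow u₁ (pk G ∸ k) * pow u₂ (val G) * pow u₃ (da G)
                 * pow u₄ (dd G) * pow α (fp G) * pow β (cyc G)

    ldSum : ℕ → ℕ → Carrier
    ldSum n k = sumR (map (λ G → if inLD n k G then weight k G else 0#) (allDigraphs n))

module Submission where

-- Delete vertex 1, the smallest vertex, from a Laguerre digraph on [n+1]: what remains is a Laguerre
-- digraph H on [n] (after relabelling), and because 1 is the smallest label no other vertex changes
-- type.  Conversely, if H has h paths, vertex 1 is put back either as an isolated vertex (a peak and a
-- new path, so u₁^(pk−k) is unchanged), as a loop (αβ), in front of one of the h sources (a double
-- ascent, u₃), behind one of the h sinks (a double descent, u₄), or between a sink and a source (a
-- valley, u₁u₂).  In the last case h − 1 paths remain, and a cycle (β) is closed exactly when the sink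
-- ends the source's own path, which gives h(β + h − 1) such insertions.  Summing over H yields
-- μ_{n+1,k} = μ_{n,k−1} + g_k μ_{n,k} + b_{k+1} μ_{n,k+1}.

open import Defs
open import Level using (Level)
open import Algebra.Bundles using (CommutativeRing)
import Algebra.Solver.CommutativeMonoid as CommutativeMonoidSolver
open import Tactic.RingSolver.Core.AlmostCommutativeRing using (fromCommutativeRing)
import Data.Nat as ℕ
open ℕ using (ℕ; zero; suc; _∸_; _≤_; _<_; z≤n; s≤s; _<ᵇ_; _≡ᵇ_; _≤ᵇ_)
import Data.Nat.Properties as ℕₚ
import Data.Fin as Fin
open Fin using (Fin; zero; suc; toℕ)
import Data.Fin.Properties as Finₚ
open import Data.Fin.Patterns using (0F; 1F; 2F)
open import Data.Maybe using (Maybe; just; nothing; _>>=_)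
import Data.Maybe as Maybe
open import Data.Maybe.Properties using (just-injective)
import Data.Vec as Vec
open Vec using (Vec; []; _∷_; lookup; _[_]≔_)
open import Data.Vec.Properties using (lookup-map; map-∘; map-cong; map-id; map-[]≔; []≔-lookup; lookup∘update; lookup∘update′)
open import Data.List using (List; []; _∷_; map; _++_; concatMap; tabulate; allFin; upTo)
open import Data.List.Membership.Propositional using (_∈_)
open import Data.List.Membership.Propositional.Properties using (∈-allFin; ∈-map⁺; ∈-map⁻; ∈-upTo⁺; ∈-upTo⁻)
open import Data.List.Relation.Unary.Any using (here; there)
open import Data.Bool using (Bool; true; false; _∧_; _∨_; not; if_then_else_; T)
open import Data.Bool.Properties using (∧-conicalˡ; ∧-conicalʳ; ∧-identityʳ; ∨-zeroʳ; ∨-identityʳ; ¬-not; T-≡)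
open import Data.Product using (∃; ∃₂; _×_; _,_; proj₁; proj₂)
open import Data.Sum using (_⊎_; inj₁; inj₂)
open import Function using (_∘_)
open import Function.Bundles using (Equivalence)
open import Relation.Nullary using (¬_; yes; no; contradiction)
open import Relation.Binary.Definitions using (tri<; tri≈; tri>)
import Relation.Binary.PropositionalEquality as ≡
open ≡ using (_≡_; _≢_)

-- ℕ addition and propositional equality are opened only in this block; the ring part below uses
-- the ring's _+_ and setoid equality under the same names.
module _ where
  open ≡ using (refl; sym; trans; cong; cong₂; subst; module ≡-Reasoning)
  open import Data.Nat using (_+_)
  open ℕₚ using ( +-suc; +-assoc; +-comm; +-cancelʳ-≡; +-cancelʳ-≤; +-mono-≤; m≤n+m; ≤-refl; ≤-trans; ≤-reflexive
                ; <-trans; <-≤-trans; <⇒≤; n<1+n; m≤n⇒m≤1+n; m+[n∸m]≡n; ≤∧≢⇒<; m<n⇒0<n∸m; m∸n≤m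
                ; ≤ᵇ⇒≤; ≤⇒≤ᵇ; ≡ᵇ⇒≡; ≡⇒≡ᵇ; <-cmp; module ≤-Reasoning)
  open Finₚ using (0≢1+n; suc-injective; toℕ-injective; toℕ≤pred[n]; pigeonhole; _≟_)
  open import Algebra.Properties.CommutativeSemigroup ℕₚ.+-commutativeSemigroup using (interchange; xy∙z≈xz∙y)

  bit : Bool → ℕ
  bit true = 1
  bit false = 0

  T⇒≡true : ∀ {b} → T b → b ≡ true
  T⇒≡true = Equivalence.to T-≡

  ≡true⇒T : ∀ {b} → b ≡ true → T b
  ≡true⇒T = Equivalence.from T-≡

  true⇔true⇒≡ : ∀ {a b : Bool} → (a ≡ true → b ≡ true) → (b ≡ true → a ≡ true) → a ≡ b
  true⇔true⇒≡ {false} {false} _ _ = refl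
  true⇔true⇒≡ {false} {true} _ from = from refl
  true⇔true⇒≡ {true} {false} to _ = sym (to refl)
  true⇔true⇒≡ {true} {true} _ _ = refl

  isNothing⁻ : ∀ {A : Set} {a : Maybe A} → isNothing a ≡ true → a ≡ nothing
  isNothing⁻ {a = nothing} _ = refl

  eqF⇒≡ : ∀ {n} (i j : Fin n) → eqF i j ≡ true → i ≡ j
  eqF⇒≡ i j eq = toℕ-injective (≡ᵇ⇒≡ (toℕ i) (toℕ j) (≡true⇒T eq))

  eqF-refl : ∀ {n} (i : Fin n) → eqF i i ≡ true
  eqF-refl i = T⇒≡true (≡⇒≡ᵇ (toℕ i) (toℕ i) refl)

  sameTarget⇒≡ : ∀ {n} (a b : Maybe (Fin n)) → sameTarget a b ≡ true → ∃ λ c → a ≡ just c × b ≡ just c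
  sameTarget⇒≡ (just x) (just y) eq with eqF⇒≡ x y eq
  ... | refl = x , refl , refl

  sameTarget-just⁻ : ∀ {n} (a : Maybe (Fin n)) c → sameTarget a (just c) ≡ true → a ≡ just c
  sameTarget-just⁻ a c eq with sameTarget⇒≡ a (just c) eq
  ... | _ , a≡ , refl = a≡

  sameTarget-just⁺ : ∀ {n} {a : Maybe (Fin n)} {c} → a ≡ just c → sameTarget a (just c) ≡ true
  sameTarget-just⁺ {c = c} refl = eqF-refl c

  sameTarget-just-false : ∀ {n} (a : Maybe (Fin n)) c → a ≢ just c → sameTarget a (just c) ≡ false
  sameTarget-just-false a c a≢ = ¬-not λ eq → a≢ (sameTarget-just⁻ a c eq)

  allB⁻ : ∀ {A : Set} {xs : List A} p → allB xs p ≡ true → ∀ {x} → x ∈ xs → p x ≡ true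
  allB⁻ {xs = y ∷ xs} p all (here refl) = ∧-conicalˡ _ _ all
  allB⁻ {xs = y ∷ xs} p all (there x∈) = allB⁻ p (∧-conicalʳ (p y) _ all) x∈

  allB⁺ : ∀ {A : Set} (xs : List A) p → (∀ {x} → x ∈ xs → p x ≡ true) → allB xs p ≡ true
  allB⁺ [] p all = refl
  allB⁺ (x ∷ xs) p all = cong₂ _∧_ (all (here refl)) (allB⁺ xs p (all ∘ there))

  anyB⁻ : ∀ {A : Set} (xs : List A) p → anyB xs p ≡ true → ∃ λ x → x ∈ xs × p x ≡ true
  anyB⁻ (x ∷ xs) p any with p x in px
  ... | true = x , here refl , px
  ... | false with anyB⁻ xs p any
  ... | y , y∈ , py = y , there y∈ , py

  anyB⁺ : ∀ {A : Set} {xs : List A} p {x} → x ∈ xs → p x ≡ true → anyB xs p ≡ true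
  anyB⁺ p (here refl) px rewrite px = refl
  anyB⁺ {xs = y ∷ _} p (there x∈) px rewrite anyB⁺ p x∈ px = ∨-zeroʳ (p y)

  countFin : (n : ℕ) → (Fin n → Bool) → ℕ
  countFin zero p = 0
  countFin (suc n) p = bit (p zero) + countFin n (p ∘ suc)

  count-tabulate : ∀ {A : Set} n (f : Fin n → A) p → count (tabulate f) p ≡ countFin n (p ∘ f)
  count-tabulate zero f p = refl
  count-tabulate (suc n) f p with p (f zero)
  ... | true = cong suc (count-tabulate n (f ∘ suc) p)
  ... | false = count-tabulate n (f ∘ suc) p

  count-allFin : ∀ n p → count (allFin n) p ≡ countFin n p
  count-allFin n = count-tabulate n (λ i → i)

  countFin-cong : ∀ n {p q : Fin n → Bool} → (∀ i → p i ≡ q i) → countFin n p ≡ countFin n q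
  countFin-cong zero eq = refl
  countFin-cong (suc n) eq = cong₂ _+_ (cong bit (eq zero)) (countFin-cong n (eq ∘ suc))

  count-allFin-suc : ∀ n (P : Fin (suc n) → Bool) (Q : Fin n → Bool) → (∀ i → P (suc i) ≡ Q i) →
                     count (allFin (suc n)) P ≡ bit (P zero) + count (allFin n) Q
  count-allFin-suc n P Q eq = trans (count-allFin (suc n) P)
    (cong (bit (P zero) +_) (trans (countFin-cong n eq) (sym (count-allFin n Q))))

  countFin-+ : ∀ n {p q r : Fin n → Bool} → (∀ i → bit (p i) + bit (q i) ≡ bit (r i)) →
               countFin n p + countFin n q ≡ countFin n r
  countFin-+ zero eq = refl
  countFin-+ (suc n) {p} {q} eq = trans (interchange (bit (p zero)) _ (bit (q zero)) _) (cong₂ _+_ (eq zero) (countFin-+ n (eq ∘ suc)))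

  countFin-none : ∀ n {p : Fin n → Bool} → (∀ i → p i ≡ false) → countFin n p ≡ 0
  countFin-none zero none = refl
  countFin-none (suc n) none rewrite none zero = countFin-none n (none ∘ suc)

  countFin≡0⇒ : ∀ n {p : Fin n → Bool} → countFin n p ≡ 0 → ∀ i → p i ≡ false
  countFin≡0⇒ (suc n) {p} eq i with p zero in pz
  countFin≡0⇒ (suc n) eq zero | false = pz
  countFin≡0⇒ (suc n) eq (suc i) | false = countFin≡0⇒ n eq i

  countFin>0⇒ : ∀ n {p : Fin n → Bool} → 1 ≤ countFin n p → ∃ λ i → p i ≡ true
  countFin>0⇒ (suc n) {p} pos with p zero in pz
  ... | true = zero , pz
  ... | false with countFin>0⇒ n pos
  ... | i , pi = suc i , pi

  countFin-unique : ∀ n {p : Fin n → Bool} i → p i ≡ true → (∀ j → p j ≡ true → j ≡ i) → countFin n p ≡ 1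
  countFin-unique (suc n) {p} zero pi unique rewrite pi =
    cong suc (countFin-none n λ j → ¬-not λ pj → 0≢1+n (sym (unique (suc j) pj)))
  countFin-unique (suc n) {p} (suc i) pi unique with p zero in pz
  ... | true = contradiction (unique zero pz) 0≢1+n
  ... | false = countFin-unique n i pi (λ j pj → suc-injective (unique (suc j) pj))

  countFin-≤1 : ∀ n {p : Fin n → Bool} → (∀ i j → p i ≡ true → p j ≡ true → i ≡ j) → countFin n p ≤ 1
  countFin-≤1 zero unique = z≤n
  countFin-≤1 (suc n) {p} unique with p zero in pz
  ... | true rewrite countFin-none n (λ i → ¬-not λ pi → 0≢1+n (unique zero (suc i) pz pi)) = ≤-refl
  ... | false = countFin-≤1 n (λ i j pi pj → suc-injective (unique (suc i) (suc j) pi pj))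

  countFin-remove : ∀ n {p : Fin n → Bool} j → p j ≡ true → suc (countFin n (λ i → not (eqF j i) ∧ p i)) ≡ countFin n p
  countFin-remove (suc n) zero pj rewrite pj = refl
  countFin-remove (suc n) {p} (suc j) pj = trans (sym (+-suc (bit (p zero)) _)) (cong (bit (p zero) +_) (countFin-remove n j pj))

  firstFin : (n : ℕ) → (Fin n → Bool) → (Fin n → ℕ) → ℕ
  firstFin zero p f = 0
  firstFin (suc n) p f = if p zero then f zero else firstFin n (p ∘ suc) (f ∘ suc)

  firstFin-cong : ∀ n {p q : Fin n → Bool} f → (∀ i → p i ≡ q i) → firstFin n p f ≡ firstFin n q f
  firstFin-cong zero f eq = refl
  firstFin-cong (suc n) f eq rewrite eq zero = cong (if_then_else_ _ (f zero)) (firstFin-cong n (f ∘ suc) (eq ∘ suc))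

  firstFin-none : ∀ n {p : Fin n → Bool} f → (∀ i → p i ≡ false) → firstFin n p f ≡ 0
  firstFin-none zero f none = refl
  firstFin-none (suc n) f none rewrite none zero = firstFin-none n (f ∘ suc) (none ∘ suc)

  firstFin-some : ∀ n {p : Fin n → Bool} f i → p i ≡ true → ∃ λ j → firstFin n p f ≡ f j
  firstFin-some (suc n) {p} f i pi with p zero in pz
  ... | true = zero , refl
  firstFin-some (suc n) f zero pi | false = contradiction (trans (sym pz) pi) λ ()
  firstFin-some (suc n) f (suc i) pi | false with firstFin-some n (f ∘ suc) i pi
  ... | j , eq = suc j , eq

  firstFin-map : ∀ n (p : Fin n → Bool) f (g : ℕ → ℕ) → g 0 ≡ 0 → firstFin n p (g ∘ f) ≡ g (firstFin n p f)
  firstFin-map zero p f g g0 = sym g0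
  firstFin-map (suc n) p f g g0 with p zero
  ... | true = refl
  ... | false = firstFin-map n (p ∘ suc) (f ∘ suc) g g0

  firstPred-tabulate : ∀ {n} (G : Digraph n) i m (g : Fin m → Fin n) →
    firstPred G i (tabulate g) ≡ firstFin m (λ j → sameTarget (lookup G (g j)) (just i)) (vlab ∘ g)
  firstPred-tabulate G i zero g = refl
  firstPred-tabulate G i (suc m) g with sameTarget (lookup G (g zero)) (just i)
  ... | true = refl
  ... | false = firstPred-tabulate G i m (g ∘ suc)

  predV≡firstFin : ∀ {n} (G : Digraph n) i → predV G i ≡ firstFin n (λ j → sameTarget (lookup G j) (just i)) vlab
  predV≡firstFin {n} G i = firstPred-tabulate G i n (λ j → j)

  IsPartialInjection : ∀ {k m} → Vec (Maybe (Fin k)) m → Set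
  IsPartialInjection v = ∀ i j {c} → lookup v i ≡ just c → lookup v j ≡ just c → i ≡ j

  isLaguerre⇒injective : ∀ {n} (G : Digraph n) → isLaguerre G ≡ true → IsPartialInjection G
  isLaguerre⇒injective G lag i j {c} Gi Gj = eqF⇒≡ i j (trans (sym (∨-identityʳ (eqF i j))) noSharedTarget)
    where
    noSharedTarget : eqF i j ∨ false ≡ true
    noSharedTarget = subst (λ t → eqF i j ∨ not t ≡ true)
      (trans (cong₂ sameTarget Gi Gj) (eqF-refl c))
      (allB⁻ _ (allB⁻ _ lag (∈-allFin i)) (∈-allFin j))

  injective⇒isLaguerre : ∀ {n} (G : Digraph n) → IsPartialInjection G → isLaguerre G ≡ true
  injective⇒isLaguerre {n} G inj = allB⁺ (allFin n) _ λ {i} _ → allB⁺ (allFin n) _ λ {j} _ → distinctTargets i j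
    where
    distinctTargets : ∀ i j → eqF i j ∨ not (sameTarget (lookup G i) (lookup G j)) ≡ true
    distinctTargets i j with eqF i j in i≠j
    ... | true = refl
    ... | false with sameTarget (lookup G i) (lookup G j) in shared
    ...   | false = refl
    ...   | true with sameTarget⇒≡ _ _ shared
    ...     | _ , Gi , Gj with inj i j Gi Gj
    ...       | refl = contradiction (trans (sym i≠j) (eqF-refl i)) λ ()

  ¬injective⇒¬isLaguerre : ∀ {n} (G : Digraph n) → ¬ IsPartialInjection G → isLaguerre G ≡ false
  ¬injective⇒¬isLaguerre G ¬inj = ¬-not λ lag → ¬inj (isLaguerre⇒injective G lag)

  injective-tail : ∀ {n m} {x : Maybe (Fin n)} {v : Vec (Maybe (Fin n)) m} →
                   IsPartialInjection (x ∷ v) → IsPartialInjection v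
  injective-tail inj i j vi vj = suc-injective (inj (suc i) (suc j) vi vj)

  injective-head : ∀ {n m} {x : Maybe (Fin n)} {v : Vec (Maybe (Fin n)) m} →
                   IsPartialInjection (x ∷ v) → ∀ i {c} → x ≡ just c → lookup v i ≢ just c
  injective-head inj i x≡ vi = 0≢1+n (inj zero (suc i) x≡ vi)

  injective-cons : ∀ {n m} {x : Maybe (Fin n)} {v : Vec (Maybe (Fin n)) m} →
                   (∀ i {c} → x ≡ just c → lookup v i ≢ just c) → IsPartialInjection v → IsPartialInjection (x ∷ v)
  injective-cons head inj zero zero _ _ = refl
  injective-cons head inj zero (suc j) x≡ vj = contradiction vj (head j x≡)
  injective-cons head inj (suc i) zero vi x≡ = contradiction vi (head i x≡)
  injective-cons head inj (suc i) (suc j) vi vj = cong suc (inj i j vi vj)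

  Source : ∀ {n} → Digraph n → Fin n → Set
  Source w j = ∀ i → lookup w i ≢ just j

  predV-source : ∀ {n} (w : Digraph n) j → Source w j → predV w j ≡ 0
  predV-source {n} w j source = trans (predV≡firstFin w j) (firstFin-none n vlab λ i → sameTarget-just-false _ j (source i))

  predV≡0⇒source : ∀ {n} (w : Digraph n) j → predV w j ≡ 0 → Source w j
  predV≡0⇒source {n} w j none i wi with firstFin-some n vlab i (sameTarget-just⁺ wi)
  ... | k , eq = contradiction (trans (sym none) (trans (predV≡firstFin w j) eq)) λ ()

  isSource : ∀ {n} → Digraph n → Fin n → Bool
  isSource w j = predV w j ≡ᵇ 0

  sources : ∀ {n} → Digraph n → ℕ
  sources {n} w = countFin n (isSource w)

  isSource⁻ : ∀ {n} (w : Digraph n) j → isSource w j ≡ true → Source w j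
  isSource⁻ w j src = predV≡0⇒source w j (≡ᵇ⇒≡ (predV w j) 0 (≡true⇒T src))

  isSource⁺ : ∀ {n} (w : Digraph n) j → Source w j → isSource w j ≡ true
  isSource⁺ w j src = cong (_≡ᵇ 0) (predV-source w j src)

  -- Walks and cycles

  just-of : ∀ {A : Set} (a : Maybe A) → a ≢ nothing → ∃ λ c → a ≡ just c
  just-of (just c) _ = c , refl
  just-of nothing defined = contradiction refl defined

  bind-just : ∀ {A B : Set} (u : Maybe A) {f : A → Maybe B} {c} → (u >>= f) ≡ just c → ∃ λ d → u ≡ just d × f d ≡ just c
  bind-just (just d) eq = d , refl , eq

  walk : ∀ {n} → Digraph n → ℕ → Maybe (Fin n) → Maybe (Fin n)
  walk G zero a = a
  walk G (suc m) a = walk G m (a >>= lookup G)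

  walk-nothing : ∀ {n} (G : Digraph n) m → walk G m nothing ≡ nothing
  walk-nothing G zero = refl
  walk-nothing G (suc m) = walk-nothing G m

  iter≡walk : ∀ {n} (G : Digraph n) m i → iter G m i ≡ walk G m (just i)
  iter≡walk G zero i = refl
  iter≡walk G (suc m) i with lookup G i
  ... | nothing = sym (walk-nothing G m)
  ... | just j = iter≡walk G m j

  walk-suc : ∀ {n} (G : Digraph n) m a → walk G (suc m) a ≡ (walk G m a >>= lookup G)
  walk-suc G zero a = refl
  walk-suc G (suc m) a = walk-suc G m (a >>= lookup G)

  walk-+ : ∀ {n} (G : Digraph n) m k a → walk G (m + k) a ≡ walk G k (walk G m a)
  walk-+ G zero k a = refl
  walk-+ G (suc m) k a = walk-+ G m k (a >>= lookup G)

  walk-stopped : ∀ {n} (G : Digraph n) {m k} a → walk G m a ≡ nothing → m ≤ k → walk G k a ≡ nothing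
  walk-stopped G {m} {k} a stop m≤k = begin
    walk G k a                    ≡⟨ cong (λ t → walk G t a) (sym (m+[n∸m]≡n m≤k)) ⟩
    walk G (m + (k ∸ m)) a        ≡⟨ walk-+ G m (k ∸ m) a ⟩
    walk G (k ∸ m) (walk G m a)   ≡⟨ cong (walk G (k ∸ m)) stop ⟩
    walk G (k ∸ m) nothing        ≡⟨ walk-nothing G (k ∸ m) ⟩
    nothing                       ∎
    where open ≡-Reasoning

  walk-past-sink : ∀ {n} (w : Digraph n) s {a e} → walk w s a ≡ just e → lookup w e ≡ nothing → walk w (suc s) a ≡ nothing
  walk-past-sink w s ws sink = trans (walk-suc w s _) (trans (cong (_>>= lookup w) ws) sink)

  walk-lastVertex : ∀ {n} (w : Digraph n) j m → walk w m (just j) ≡ nothing →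
                    ∃ λ t → ∃ λ e → walk w t (just j) ≡ just e × lookup w e ≡ nothing
  walk-lastVertex w j (suc m) stop with walk w m (just j) in wm
  ... | nothing = walk-lastVertex w j m wm
  ... | just e = m , e , wm , trans (sym (cong (_>>= lookup w) wm)) (trans (sym (walk-suc w m _)) stop)


  walk-periodic : ∀ {n} (G : Digraph n) {p} a → 1 ≤ p → walk G p a ≡ a → ∀ t → ∃ λ r → r < p × walk G t a ≡ walk G r a
  walk-periodic G a 1≤p period zero = 0 , 1≤p , refl
  walk-periodic G {p} a 1≤p period (suc t) with walk-periodic G a 1≤p period t
  ... | r , r<p , eq with suc r ℕ.≟ p
  ...   | yes refl = 0 , 1≤p , trans (walk-suc G t a) (trans (cong (_>>= lookup G) eq) (trans (sym (walk-suc G r a)) period))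
  ...   | no r+1≢p = suc r , ≤∧≢⇒< r<p r+1≢p , trans (walk-suc G t a) (trans (cong (_>>= lookup G) eq) (sym (walk-suc G r a)))

  walk-periodic-defined : ∀ {n} (G : Digraph n) {p i} → 1 ≤ p → walk G p (just i) ≡ just i → ∀ t → walk G t (just i) ≢ nothing
  walk-periodic-defined G {p} 1≤p period t stop with walk-periodic G _ 1≤p period t
  ... | r , r<p , eq = contradiction (trans (sym period) (walk-stopped G _ (trans (sym eq) stop) (<⇒≤ r<p))) λ ()

  walk-cancel : ∀ {n} (G : Digraph n) → IsPartialInjection G → ∀ {a b x c} →
                walk G a x ≡ just c → walk G b x ≡ just c → a ≤ b → x ≡ walk G (b ∸ a) x
  walk-cancel G inj {zero} wa wb z≤n = trans wa (sym wb)
  walk-cancel G inj {suc a} {suc b} {x} wa wb (s≤s a≤b)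
    with bind-just (walk G a x) (trans (sym (walk-suc G a x)) wa)
       | bind-just (walk G b x) (trans (sym (walk-suc G b x)) wb)
  ... | d , wa′ , Gd | d′ , wb′ , Gd′ with inj d d′ Gd Gd′
  ... | refl = walk-cancel G inj wa′ wb′ a≤b

  OnCycle : ∀ {n} → Digraph n → Fin n → Set
  OnCycle {n} G i = ∃ λ p → 1 ≤ p × p ≤ n × walk G p (just i) ≡ just i

  MinimalOnOrbit : ∀ {n} → Digraph n → Fin n → Set
  MinimalOnOrbit G i = ∀ t {c} → walk G t (just i) ≡ just c → toℕ i ≤ toℕ c

  CycleMin : ∀ {n} → Digraph n → Fin n → Set
  CycleMin G i = OnCycle G i × MinimalOnOrbit G i

  walk-defined⇒onCycle : ∀ {n} (G : Digraph n) → IsPartialInjection G → ∀ i → walk G n (just i) ≢ nothing → OnCycle G i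
  walk-defined⇒onCycle {n} G inj i defined = returns (pigeonhole (n<1+n n) (proj₁ ∘ vertexAt))
    where
    vertexAt : (t : Fin (suc n)) → ∃ λ c → walk G (toℕ t) (just i) ≡ just c
    vertexAt t = just-of _ λ stop → defined (walk-stopped G _ stop (toℕ≤pred[n] t))
    returns : (∃₂ λ a b → a Fin.< b × proj₁ (vertexAt a) ≡ proj₁ (vertexAt b)) → OnCycle G i
    returns (a , b , a<b , same) = toℕ b ∸ toℕ a , m<n⇒0<n∸m a<b , ≤-trans (m∸n≤m (toℕ b) (toℕ a)) (toℕ≤pred[n] b) ,
      sym (walk-cancel G inj (trans (proj₂ (vertexAt a)) (cong just same)) (proj₂ (vertexAt b)) (<⇒≤ a<b))

  onCycle⁻ : ∀ {n} (G : Digraph n) i → onCycle G i ≡ true → OnCycle G i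
  onCycle⁻ {n} G i on with anyB⁻ (map suc (upTo n)) _ on
  ... | p , p∈ , returns with ∈-map⁻ suc p∈
  ... | m , m∈ , refl =
    suc m , s≤s z≤n , ∈-upTo⁻ m∈ , trans (sym (iter≡walk G (suc m) i)) (sameTarget-just⁻ _ i returns)

  onCycle⁺ : ∀ {n} (G : Digraph n) i → OnCycle G i → onCycle G i ≡ true
  onCycle⁺ G i (suc m , _ , p≤n , returns) =
    anyB⁺ _ (∈-map⁺ suc (∈-upTo⁺ p≤n)) (sameTarget-just⁺ (trans (iter≡walk G (suc m) i) returns))

  leTarget⁻ : ∀ {n} (i : Fin n) a → leTarget i a ≡ true → ∀ {c} → a ≡ just c → toℕ i ≤ toℕ c
  leTarget⁻ i (just c) le refl = ≤ᵇ⇒≤ (toℕ i) (toℕ c) (≡true⇒T le)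

  leTarget⁺ : ∀ {n} (i : Fin n) a → (∀ {c} → a ≡ just c → toℕ i ≤ toℕ c) → leTarget i a ≡ true
  leTarget⁺ i nothing le = refl
  leTarget⁺ i (just c) le = T⇒≡true (≤⇒≤ᵇ (le refl))

  cycleMin⁻ : ∀ {n} (G : Digraph n) i → cycleMin G i ≡ true → CycleMin G i
  cycleMin⁻ {n} G i cm = cycle , minimal
    where
    cycle = onCycle⁻ G i (∧-conicalˡ _ _ cm)
    minimal : MinimalOnOrbit G i
    minimal t reaches with cycle
    ... | p , 1≤p , p≤n , period with walk-periodic G _ 1≤p period t
    ... | r , r<p , eq = leTarget⁻ i _
            (subst (λ a → leTarget i a ≡ true) (iter≡walk G r i)
              (allB⁻ _ (∧-conicalʳ (onCycle G i) _ cm) (∈-upTo⁺ (<-≤-trans r<p p≤n))))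
            (trans (sym eq) reaches)

  cycleMin⁺ : ∀ {n} (G : Digraph n) i → CycleMin G i → cycleMin G i ≡ true
  cycleMin⁺ {n} G i (cycle , minimal) = cong₂ _∧_ (onCycle⁺ G i cycle)
    (allB⁺ (upTo n) _ λ {t} _ → leTarget⁺ i _ λ reaches → minimal t (trans (sym (iter≡walk G t i)) reaches))

  cycleMin-cong : ∀ {n m} (G : Digraph n) i (H : Digraph m) j →
                  (CycleMin G i → CycleMin H j) → (CycleMin H j → CycleMin G i) → cycleMin G i ≡ cycleMin H j
  cycleMin-cong G i H j to from = true⇔true⇒≡ (cycleMin⁺ H j ∘ to ∘ cycleMin⁻ G i) (cycleMin⁺ G i ∘ from ∘ cycleMin⁻ H j)

  -- Vertex zero of Fin (suc n) is vertex 1 of [n+1].  lower deletes it (edges into it become sinks) and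
  -- renumbers the others; lift puts it back without edges, lift⁺ w e with the single edge e → 1.
  lowerᵗ : ∀ {n} → Maybe (Fin (suc n)) → Maybe (Fin n)
  lowerᵗ nothing = nothing
  lowerᵗ (just zero) = nothing
  lowerᵗ (just (suc j)) = just j

  liftᵗ : ∀ {n} → Maybe (Fin n) → Maybe (Fin (suc n))
  liftᵗ = Maybe.map suc

  lower : ∀ {n m} → Vec (Maybe (Fin (suc n))) m → Vec (Maybe (Fin n)) m
  lower = Vec.map lowerᵗ

  lift : ∀ {n m} → Vec (Maybe (Fin n)) m → Vec (Maybe (Fin (suc n))) m
  lift = Vec.map liftᵗ

  lift⁺ : ∀ {n m} → Vec (Maybe (Fin n)) m → Fin m → Vec (Maybe (Fin (suc n))) m
  lift⁺ w e = lift w [ e ]≔ just zero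

  pointsTo₀ : ∀ {n} → Maybe (Fin (suc n)) → Bool
  pointsTo₀ (just zero) = true
  pointsTo₀ _ = false

  indeg₀ : ∀ {n m} → Vec (Maybe (Fin (suc n))) m → ℕ
  indeg₀ {m = m} v = countFin m (pointsTo₀ ∘ lookup v)

  lookup-lower : ∀ {n m} (v : Vec (Maybe (Fin (suc n))) m) i → lookup (lower v) i ≡ lowerᵗ (lookup v i)
  lookup-lower v i = lookup-map i lowerᵗ v

  lookup-lift : ∀ {n m} (w : Vec (Maybe (Fin n)) m) i → lookup (lift w) i ≡ liftᵗ (lookup w i)
  lookup-lift w i = lookup-map i liftᵗ w

  lowerᵗ≡just⁻ : ∀ {n} (a : Maybe (Fin (suc n))) {c} → lowerᵗ a ≡ just c → a ≡ just (suc c)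
  lowerᵗ≡just⁻ (just (suc j)) refl = refl

  liftᵗ≡just⁻ : ∀ {n} (a : Maybe (Fin n)) {c} → liftᵗ a ≡ just c → ∃ λ c′ → c ≡ suc c′ × a ≡ just c′
  liftᵗ≡just⁻ (just c′) refl = c′ , refl , refl

  lower-lift : ∀ {n m} (w : Vec (Maybe (Fin n)) m) → lower (lift w) ≡ w
  lower-lift w = trans (sym (map-∘ lowerᵗ liftᵗ w)) (trans (map-cong lowerᵗ∘liftᵗ w) (map-id w))
    where
    lowerᵗ∘liftᵗ : ∀ a → lowerᵗ (liftᵗ a) ≡ a
    lowerᵗ∘liftᵗ nothing = refl
    lowerᵗ∘liftᵗ (just _) = refl

  lower-lift⁺ : ∀ {n m} (w : Vec (Maybe (Fin n)) m) e → lookup w e ≡ nothing → lower (lift⁺ w e) ≡ w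
  lower-lift⁺ w e sink = begin
    lower (lift w [ e ]≔ just zero)   ≡⟨ map-[]≔ lowerᵗ (lift w) e ⟩
    lower (lift w) [ e ]≔ nothing     ≡⟨ cong (λ u → u [ e ]≔ nothing) (lower-lift w) ⟩
    w [ e ]≔ nothing                  ≡⟨ cong (w [ e ]≔_) (sym sink) ⟩
    w [ e ]≔ lookup w e               ≡⟨ []≔-lookup w e ⟩
    w                                 ∎
    where open ≡-Reasoning

  lookup-lift⁺-self : ∀ {n m} (w : Vec (Maybe (Fin n)) m) e → lookup (lift⁺ w e) e ≡ just zero
  lookup-lift⁺-self w e = lookup∘update e (lift w) (just zero)

  lookup-lift⁺⁻ : ∀ {n m} (w : Vec (Maybe (Fin n)) m) e i {c} → lookup (lift⁺ w e) i ≡ just c →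
                  (i ≡ e × c ≡ zero) ⊎ (∃ λ c′ → c ≡ suc c′ × lookup w i ≡ just c′)
  lookup-lift⁺⁻ w e i eq with i ≟ e
  ... | yes refl = inj₁ (refl , just-injective (trans (sym eq) (lookup-lift⁺-self w e)))
  ... | no i≢e = inj₂ (liftᵗ≡just⁻ (lookup w i)
                  (trans (sym (lookup-map i liftᵗ w)) (trans (sym (lookup∘update′ i≢e (lift w) (just zero))) eq)))

  lift-noEdgeInto₀ : ∀ {n m} (w : Vec (Maybe (Fin n)) m) i → lookup (lift w) i ≢ just zero
  lift-noEdgeInto₀ w i into₀ with liftᵗ≡just⁻ (lookup w i) (trans (sym (lookup-lift w i)) into₀)
  ... | _ , () , _

  lower-suc : ∀ {n m} {v : Vec (Maybe (Fin (suc n))) m} {w} → lower v ≡ w → ∀ i {c} →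
              lookup v i ≡ just (suc c) → lookup w i ≡ just c
  lower-suc {v = v} refl i vi = trans (lookup-lower v i) (cong lowerᵗ vi)

  indeg₀-lift : ∀ {n m} (w : Vec (Maybe (Fin n)) m) → indeg₀ (lift w) ≡ 0
  indeg₀-lift [] = refl
  indeg₀-lift (nothing ∷ w) = indeg₀-lift w
  indeg₀-lift (just _ ∷ w) = indeg₀-lift w

  indeg₀-lift⁺ : ∀ {n m} (w : Vec (Maybe (Fin n)) m) e → indeg₀ (lift⁺ w e) ≡ 1
  indeg₀-lift⁺ (a ∷ w) zero = cong suc (indeg₀-lift w)
  indeg₀-lift⁺ (nothing ∷ w) (suc e) = indeg₀-lift⁺ w e
  indeg₀-lift⁺ (just _ ∷ w) (suc e) = indeg₀-lift⁺ w e

  injective-lower : ∀ {n m} (v : Vec (Maybe (Fin (suc n))) m) → IsPartialInjection v → IsPartialInjection (lower v)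
  injective-lower v inj i j vi vj =
    inj i j (lowerᵗ≡just⁻ _ (trans (sym (lookup-lower v i)) vi)) (lowerᵗ≡just⁻ _ (trans (sym (lookup-lower v j)) vj))

  injective-lift : ∀ {n m} (w : Vec (Maybe (Fin n)) m) → IsPartialInjection w → IsPartialInjection (lift w)
  injective-lift w inj i j wi wj
    with liftᵗ≡just⁻ (lookup w i) (trans (sym (lookup-lift w i)) wi) | liftᵗ≡just⁻ (lookup w j) (trans (sym (lookup-lift w j)) wj)
  ... | c , refl , wi′ | .c , refl , wj′ = inj i j wi′ wj′

  injective-lift⁺ : ∀ {n m} (w : Vec (Maybe (Fin n)) m) e → IsPartialInjection w → IsPartialInjection (lift⁺ w e)
  injective-lift⁺ w e inj i j wi wj with lookup-lift⁺⁻ w e i wi | lookup-lift⁺⁻ w e j wj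
  ... | inj₁ (refl , _) | inj₁ (refl , _) = refl
  ... | inj₁ (_ , refl) | inj₂ (_ , () , _)
  ... | inj₂ (_ , refl , _) | inj₁ (_ , ())
  ... | inj₂ (c , refl , wi′) | inj₂ (.c , refl , wj′) = inj i j wi′ wj′

  indeg₀≤1 : ∀ {n m} (v : Vec (Maybe (Fin (suc n))) m) → IsPartialInjection v → indeg₀ v ≤ 1
  indeg₀≤1 {m = m} v inj = countFin-≤1 m λ i j vi vj → inj i j (pointsTo₀⁻ _ vi) (pointsTo₀⁻ _ vj)
    where
    pointsTo₀⁻ : ∀ {n} (a : Maybe (Fin (suc n))) → pointsTo₀ a ≡ true → a ≡ just zero
    pointsTo₀⁻ (just zero) _ = refl

  indeg₀-cases : ∀ {n m} (v : Vec (Maybe (Fin (suc n))) m) → IsPartialInjection v → indeg₀ v ≡ 0 ⊎ indeg₀ v ≡ 1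
  indeg₀-cases v inj with indeg₀ v | indeg₀≤1 v inj
  ... | zero | _ = inj₁ refl
  ... | suc zero | _ = inj₂ refl
  ... | suc (suc _) | s≤s ()

  indeg₀-loop : ∀ {n} {v : Vec (Maybe (Fin (suc n))) n} → IsPartialInjection (just zero ∷ v) → indeg₀ v ≡ 0
  indeg₀-loop {n} {v} inj = countFin-none n λ i → notInto₀ (lookup v i) (injective-head inj i refl)
    where
    notInto₀ : (a : Maybe (Fin (suc n))) → a ≢ just zero → pointsTo₀ a ≡ false
    notInto₀ nothing _ = refl
    notInto₀ (just zero) a≢ = contradiction refl a≢
    notInto₀ (just (suc _)) _ = refl

  source-of-head : ∀ {n} {x : Maybe (Fin (suc n))} {v : Vec (Maybe (Fin (suc n))) n} →
                   IsPartialInjection (x ∷ v) → ∀ {j} → x ≡ just (suc j) → Source (lower v) j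
  source-of-head {v = v} inj x≡ k wk = injective-head inj k x≡ (lowerᵗ≡just⁻ _ (trans (sym (lookup-lower v k)) wk))

  injective-prepend : ∀ {n} {v : Vec (Maybe (Fin (suc n))) n} {w j} → lower v ≡ w → IsPartialInjection v → Source w j →
                      IsPartialInjection (just (suc j) ∷ v)
  injective-prepend lowered inj source = injective-cons (λ { i refl vi → source i (lower-suc lowered i vi) }) inj

  shiftLabel : ℕ → ℕ
  shiftLabel zero = zero
  shiftLabel (suc m) = suc (suc m)

  -- How the label of a neighbour of vertex suc i in x ∷ v relates to that of vertex i in lower v:
  -- shifted by one, or the neighbour is vertex 1, which lower v does not have.
  Relabelled : ℕ → ℕ → Set
  Relabelled P P′ = P ≡ shiftLabel P′ ⊎ (P ≡ 1 × P′ ≡ 0)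

  relabel-below : ∀ {P P′} t → Relabelled P P′ → (P <ᵇ suc (suc t)) ≡ (P′ <ᵇ suc t)
  relabel-below {P′ = zero} t (inj₁ refl) = refl
  relabel-below {P′ = suc _} t (inj₁ refl) = refl
  relabel-below t (inj₂ (refl , refl)) = refl

  relabel-above : ∀ {P P′} t → Relabelled P P′ → (suc (suc t) <ᵇ P) ≡ (suc t <ᵇ P′)
  relabel-above {P′ = zero} t (inj₁ refl) = refl
  relabel-above {P′ = suc _} t (inj₁ refl) = refl
  relabel-above t (inj₂ (refl , refl)) = refl

  relabel-equal : ∀ {P P′} t → Relabelled P P′ → (P ≡ᵇ suc (suc t)) ≡ (P′ ≡ᵇ suc t)
  relabel-equal {P′ = zero} t (inj₁ refl) = refl
  relabel-equal {P′ = suc _} t (inj₁ refl) = refl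
  relabel-equal t (inj₂ (refl , refl)) = refl

  sameTarget-lowerᵗ : ∀ {n} (a : Maybe (Fin (suc n))) i → sameTarget a (just (suc i)) ≡ sameTarget (lowerᵗ a) (just i)
  sameTarget-lowerᵗ nothing i = refl
  sameTarget-lowerᵗ (just zero) i = refl
  sameTarget-lowerᵗ (just (suc j)) i = refl

  sameTarget-zero : ∀ {n} (a : Maybe (Fin (suc n))) → sameTarget a (just zero) ≡ pointsTo₀ a
  sameTarget-zero nothing = refl
  sameTarget-zero (just zero) = refl
  sameTarget-zero (just (suc j)) = refl

  module Deletion {n : ℕ} (x : Maybe (Fin (suc n))) (v : Vec (Maybe (Fin (suc n))) n) where

    G : Digraph (suc n)
    G = x ∷ v

    w : Digraph n
    w = lower v

    predV-suc : ∀ i → predV G (suc i) ≡ (if sameTarget x (just (suc i)) then 1 else shiftLabel (predV w i))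
    predV-suc i = trans (predV≡firstFin G (suc i)) (cong (if_then_else_ (sameTarget x (just (suc i))) 1) (begin
      firstFin n (λ j → sameTarget (lookup v j) (just (suc i))) (shiftLabel ∘ vlab)
        ≡⟨ firstFin-cong n _ (λ j → trans (sameTarget-lowerᵗ (lookup v j) i)
                                          (cong (λ a → sameTarget a (just i)) (sym (lookup-lower v j)))) ⟩
      firstFin n (λ j → sameTarget (lookup w j) (just i)) (shiftLabel ∘ vlab)
        ≡⟨ firstFin-map n _ vlab shiftLabel refl ⟩
      shiftLabel (firstFin n (λ j → sameTarget (lookup w j) (just i)) vlab)
        ≡⟨ cong shiftLabel (sym (predV≡firstFin w i)) ⟩
      shiftLabel (predV w i) ∎))
      where open ≡-Reasoning

    pred₀ : ℕ
    pred₀ = firstFin n (pointsTo₀ ∘ lookup v) (vlab ∘ suc)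

    predV-zero : predV G zero ≡ (if pointsTo₀ x then 1 else pred₀)
    predV-zero = trans (predV≡firstFin G zero) (trans (cong (λ b → if b then 1 else _) (sameTarget-zero x))
      (cong (if_then_else_ (pointsTo₀ x) 1) (firstFin-cong n _ (λ j → sameTarget-zero (lookup v j)))))

    pred₀-none : indeg₀ v ≡ 0 → pred₀ ≡ 0
    pred₀-none none = firstFin-none n _ (countFin≡0⇒ n none)

    pred₀-some : 1 ≤ indeg₀ v → ∃ λ m → pred₀ ≡ suc (suc m)
    pred₀-some some with countFin>0⇒ n some
    ... | i , vi with firstFin-some n (vlab ∘ suc) i vi
    ... | j , eq = toℕ j , eq

    predV-relabelled : IsPartialInjection G → ∀ i → Relabelled (predV G (suc i)) (predV w i)
    predV-relabelled inj i = relabel _ (predV-suc i) refl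
      where
      relabel : ∀ b → predV G (suc i) ≡ (if b then 1 else shiftLabel (predV w i)) → sameTarget x (just (suc i)) ≡ b →
                Relabelled (predV G (suc i)) (predV w i)
      relabel false eq _ = inj₁ eq
      relabel true eq x→i = inj₂ (eq , predV-source w i (source-of-head inj (sameTarget-just⁻ x (suc i) x→i)))

    succV-relabelled : ∀ i → Relabelled (succV G (suc i)) (succV w i)
    succV-relabelled i rewrite lookup-lower v i with lookup v i
    ... | nothing = inj₁ refl
    ... | just zero = inj₂ (refl , refl)
    ... | just (suc j) = inj₁ refl

    module _ (inj : IsPartialInjection G) where

      isPk-suc : ∀ i → isPk G (suc i) ≡ isPk w i
      isPk-suc i = cong₂ _∧_ (relabel-below (toℕ i) (predV-relabelled inj i)) (relabel-below (toℕ i) (succV-relabelled i))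

      isVal-suc : ∀ i → isVal G (suc i) ≡ isVal w i
      isVal-suc i = cong₂ _∧_ (relabel-above (toℕ i) (predV-relabelled inj i)) (relabel-above (toℕ i) (succV-relabelled i))

      isDa-suc : ∀ i → isDa G (suc i) ≡ isDa w i
      isDa-suc i = cong₂ _∧_ (relabel-below (toℕ i) (predV-relabelled inj i)) (relabel-above (toℕ i) (succV-relabelled i))

      isDd-suc : ∀ i → isDd G (suc i) ≡ isDd w i
      isDd-suc i = cong₂ _∧_ (relabel-above (toℕ i) (predV-relabelled inj i)) (relabel-below (toℕ i) (succV-relabelled i))

      isFp-suc : ∀ i → isFp G (suc i) ≡ isFp w i
      isFp-suc i = cong₂ _∧_ (relabel-equal (toℕ i) (predV-relabelled inj i)) (relabel-equal (toℕ i) (succV-relabelled i))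

      pk-cons : pk G ≡ bit (isPk G zero) + pk w
      pk-cons = count-allFin-suc n (isPk G) (isPk w) isPk-suc

      val-cons : val G ≡ bit (isVal G zero) + val w
      val-cons = count-allFin-suc n (isVal G) (isVal w) isVal-suc

      da-cons : da G ≡ bit (isDa G zero) + da w
      da-cons = count-allFin-suc n (isDa G) (isDa w) isDa-suc

      dd-cons : dd G ≡ bit (isDd G zero) + dd w
      dd-cons = count-allFin-suc n (isDd G) (isDd w) isDd-suc

      fp-cons : fp G ≡ bit (isFp G zero) + fp w
      fp-cons = count-allFin-suc n (isFp G) (isFp w) isFp-suc

    paths-cons : paths G + indeg₀ v ≡ bit (isNothing x) + paths w
    paths-cons = begin
      paths G + indeg₀ v
        ≡⟨ cong (_+ indeg₀ v) (count-allFin (suc n) _) ⟩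
      bit (isNothing x) + countFin n (isNothing ∘ lookup v) + indeg₀ v
        ≡⟨ +-assoc (bit (isNothing x)) _ _ ⟩
      bit (isNothing x) + (countFin n (isNothing ∘ lookup v) + indeg₀ v)
        ≡⟨ cong (bit (isNothing x) +_) (countFin-+ n λ i →
             trans (sinkOrInto₀ (lookup v i)) (cong (bit ∘ isNothing) (sym (lookup-lower v i)))) ⟩
      bit (isNothing x) + countFin n (isNothing ∘ lookup w)
        ≡⟨ cong (bit (isNothing x) +_) (sym (count-allFin n _)) ⟩
      bit (isNothing x) + paths w ∎
      where
      open ≡-Reasoning
      sinkOrInto₀ : (a : Maybe (Fin (suc n))) → bit (isNothing a) + bit (pointsTo₀ a) ≡ bit (isNothing (lowerᵗ a))
      sinkOrInto₀ nothing = refl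
      sinkOrInto₀ (just zero) = refl
      sinkOrInto₀ (just (suc j)) = refl

    Enters₀ : Fin n → ℕ → Set
    Enters₀ i m = ∃ λ t → t < m × walk G (suc t) (just (suc i)) ≡ just zero ×
                     ∃ λ c → walk w t (just i) ≡ just c × lookup v c ≡ just zero

    walk-lower : ∀ i m → walk G m (just (suc i)) ≡ liftᵗ (walk w m (just i)) ⊎ Enters₀ i m
    walk-lower i zero = inj₁ refl
    walk-lower i (suc m) with walk-lower i m
    ... | inj₂ (t , t<m , rest) = inj₂ (t , m≤n⇒m≤1+n t<m , rest)
    ... | inj₁ mirror = continue (walk w m (just i)) refl
      where
      walkG-next : walk G (suc m) (just (suc i)) ≡ (liftᵗ (walk w m (just i)) >>= lookup G)
      walkG-next = trans (walk-suc G m _) (cong (_>>= lookup G) mirror)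
      continue : ∀ u → walk w m (just i) ≡ u → walk G (suc m) (just (suc i)) ≡ liftᵗ (walk w (suc m) (just i)) ⊎ Enters₀ i (suc m)
      continue nothing wm = inj₁ (trans walkG-next (trans (cong (λ a → liftᵗ a >>= lookup G) wm)
                                   (cong liftᵗ (sym (trans (walk-suc w m _) (cong (_>>= lookup w) wm))))))
      continue (just c) wm = next (lookup v c) refl
        where
        walkG≡ : walk G (suc m) (just (suc i)) ≡ lookup v c
        walkG≡ = trans walkG-next (cong (λ a → liftᵗ a >>= lookup G) wm)
        walkw≡ : walk w (suc m) (just i) ≡ lowerᵗ (lookup v c)
        walkw≡ = trans (walk-suc w m _) (trans (cong (_>>= lookup w) wm) (lookup-lower v c))
        next : ∀ a → lookup v c ≡ a → walk G (suc m) (just (suc i)) ≡ liftᵗ (walk w (suc m) (just i)) ⊎ Enters₀ i (suc m)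
        next nothing vc = inj₁ (trans walkG≡ (trans vc (cong liftᵗ (sym (trans walkw≡ (cong lowerᵗ vc))))))
        next (just zero) vc = inj₂ (m , ≤-refl , trans walkG≡ vc , c , wm , vc)
        next (just (suc d)) vc = inj₁ (trans walkG≡ (trans vc (cong liftᵗ (sym (trans walkw≡ (cong lowerᵗ vc))))))

    module _ (inj : IsPartialInjection G) where

      cycleMin-suc : ∀ i → cycleMin G (suc i) ≡ cycleMin w i
      cycleMin-suc i = cycleMin-cong G (suc i) w i toLower toG
        where
        injw : IsPartialInjection w
        injw = injective-lower v (injective-tail inj)

        toLower : CycleMin G (suc i) → CycleMin w i
        toLower ((p , 1≤p , _ , period) , minimal) =
          walk-defined⇒onCycle w injw i (walk-periodic-defined w 1≤p periodw n) , minimalw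
          where
          mirror : ∀ m → walk G m (just (suc i)) ≡ liftᵗ (walk w m (just i))
          mirror m with walk-lower i m
          ... | inj₁ eq = eq
          ... | inj₂ (t , _ , hits0 , _) with minimal (suc t) hits0
          ... | ()
          periodw : walk w p (just i) ≡ just i
          periodw with liftᵗ≡just⁻ (walk w p (just i)) (trans (sym (mirror p)) period)
          ... | _ , refl , eq = eq
          minimalw : MinimalOnOrbit w i
          minimalw t reaches with minimal t (trans (mirror t) (cong liftᵗ reaches))
          ... | s≤s le = le

        toG : CycleMin w i → CycleMin G (suc i)
        toG ((p , 1≤p , p≤n , period) , minimal) = (p , 1≤p , m≤n⇒m≤1+n p≤n , trans (mirror p) (cong liftᵗ period)) , minimalG
          where
          mirror : ∀ m → walk G m (just (suc i)) ≡ liftᵗ (walk w m (just i))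
          mirror m with walk-lower i m
          ... | inj₁ eq = eq
          ... | inj₂ (t , _ , _ , c , wt , vc) = contradiction
                (trans (walk-suc w t _) (trans (cong (_>>= lookup w) wt) (trans (lookup-lower v c) (cong lowerᵗ vc))))
                (walk-periodic-defined w 1≤p period (suc t))
          minimalG : MinimalOnOrbit G (suc i)
          minimalG t reaches with liftᵗ≡just⁻ (walk w t (just i)) (trans (sym (mirror t)) reaches)
          ... | _ , refl , eq = s≤s (minimal t eq)

      cyc-cons : cyc G ≡ bit (onCycle G zero) + cyc w
      cyc-cons = trans (count-allFin-suc n (cycleMin G) (cycleMin w) cycleMin-suc) (cong (λ b → bit b + cyc w) cycleMin-zero)
        where
        cycleMin-zero : cycleMin G zero ≡ onCycle G zero
        cycleMin-zero = trans (cong (onCycle G zero ∧_) (allB⁺ (upTo (suc n)) (λ m → leTarget zero (iter G m zero))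
                                                           λ {m} _ → leTarget⁺ zero (iter G m zero) λ _ → z≤n))
                              (∧-identityʳ _)

    isSource-suc : ∀ i → isSource G (suc i) ≡ not (sameTarget x (just (suc i))) ∧ isSource w i
    isSource-suc i rewrite predV-suc i with sameTarget x (just (suc i))
    ... | true = refl
    ... | false with predV w i
    ...   | zero = refl
    ...   | suc _ = refl

    pred₀-balance : IsPartialInjection v → bit (pred₀ ≡ᵇ 0) + indeg₀ v ≡ 1
    pred₀-balance inj with indeg₀-cases v inj
    ... | inj₁ none = cong₂ _+_ (cong (λ p → bit (p ≡ᵇ 0)) (pred₀-none none)) none
    ... | inj₂ one with pred₀-some (≤-reflexive (sym one))
    ...   | _ , eq = cong₂ _+_ (cong (λ p → bit (p ≡ᵇ 0)) eq) one

    sourcesAbove : (∀ i → sameTarget x (just (suc i)) ≡ false) → countFin n (isSource G ∘ suc) ≡ sources w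
    sourcesAbove untargeted = countFin-cong n λ i → trans (isSource-suc i) (cong (λ b → not b ∧ isSource w i) (untargeted i))

    sourcesAbove-suc : IsPartialInjection G → ∀ {j} → x ≡ just (suc j) → suc (countFin n (isSource G ∘ suc)) ≡ sources w
    sourcesAbove-suc inj {j} refl = trans (cong suc (countFin-cong n isSource-suc))
                                          (countFin-remove n j (isSource⁺ w j (source-of-head inj refl)))

    sources-cons : IsPartialInjection G → sources G + indeg₀ v ≡ bit (isNothing x) + sources w
    sources-cons inj = byHead x refl
      where
      open ≡-Reasoning
      byHead : ∀ y → x ≡ y → sources G + indeg₀ v ≡ bit (isNothing x) + sources w
      byHead nothing refl = begin
        bit (predV G zero ≡ᵇ 0) + countFin n (isSource G ∘ suc) + indeg₀ v
          ≡⟨ cong₂ (λ p s → bit (p ≡ᵇ 0) + s + indeg₀ v) predV-zero (sourcesAbove λ _ → refl) ⟩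
        bit (pred₀ ≡ᵇ 0) + sources w + indeg₀ v
          ≡⟨ xy∙z≈xz∙y (bit (pred₀ ≡ᵇ 0)) (sources w) (indeg₀ v) ⟩
        bit (pred₀ ≡ᵇ 0) + indeg₀ v + sources w
          ≡⟨ cong (_+ sources w) (pred₀-balance (injective-tail inj)) ⟩
        1 + sources w ∎
      byHead (just zero) refl = begin
        bit (predV G zero ≡ᵇ 0) + countFin n (isSource G ∘ suc) + indeg₀ v
          ≡⟨ cong₂ (λ p s → bit (p ≡ᵇ 0) + s + indeg₀ v) predV-zero (sourcesAbove λ _ → refl) ⟩
        sources w + indeg₀ v
          ≡⟨ cong (sources w +_) (indeg₀-loop inj) ⟩
        sources w + 0
          ≡⟨ +-comm (sources w) 0 ⟩
        sources w ∎
      byHead (just (suc j)) refl = begin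
        bit (predV G zero ≡ᵇ 0) + C + indeg₀ v
          ≡⟨ cong (λ p → bit (p ≡ᵇ 0) + C + indeg₀ v) predV-zero ⟩
        bit (pred₀ ≡ᵇ 0) + C + indeg₀ v
          ≡⟨ xy∙z≈xz∙y (bit (pred₀ ≡ᵇ 0)) C (indeg₀ v) ⟩
        bit (pred₀ ≡ᵇ 0) + indeg₀ v + C
          ≡⟨ cong (_+ C) (pred₀-balance (injective-tail inj)) ⟩
        suc C
          ≡⟨ sourcesAbove-suc inj refl ⟩
        sources w ∎
        where C = countFin n (isSource G ∘ suc)

  -- Sources, sinks and peaks

  sources≡paths : ∀ {n} (G : Digraph n) → IsPartialInjection G → sources G ≡ paths G
  sources≡paths [] _ = refl
  sources≡paths (x ∷ v) inj = +-cancelʳ-≡ (indeg₀ v) _ _ (begin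
    sources G + indeg₀ v          ≡⟨ sources-cons inj ⟩
    bit (isNothing x) + sources w ≡⟨ cong (bit (isNothing x) +_) (sources≡paths w (injective-lower v (injective-tail inj))) ⟩
    bit (isNothing x) + paths w   ≡⟨ sym paths-cons ⟩
    paths G + indeg₀ v            ∎)
    where
    open Deletion x v
    open ≡-Reasoning

  paths≤pk : ∀ {n} (G : Digraph n) → IsPartialInjection G → paths G ≤ pk G
  paths≤pk [] _ = z≤n
  paths≤pk {suc n} (x ∷ v) inj = +-cancelʳ-≤ (indeg₀ v) _ _ (begin
    paths G + indeg₀ v                          ≡⟨ paths-cons ⟩
    bit (isNothing x) + paths w                 ≤⟨ +-mono-≤ (vertex₀-peak x refl) (paths≤pk w (injective-lower v injv)) ⟩
    bit (isPk G zero) + indeg₀ v + pk w         ≡⟨ xy∙z≈xz∙y (bit (isPk G zero)) (indeg₀ v) (pk w) ⟩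
    bit (isPk G zero) + pk w + indeg₀ v         ≡⟨ cong (_+ indeg₀ v) (sym (pk-cons inj)) ⟩
    pk G + indeg₀ v                             ∎)
    where
    open Deletion x v
    open ≤-Reasoning
    injv = injective-tail inj
    vertex₀-peak : ∀ y → x ≡ y → bit (isNothing x) ≤ bit (isPk G zero) + indeg₀ v
    vertex₀-peak (just _) refl = z≤n
    vertex₀-peak nothing refl with indeg₀-cases v injv
    ... | inj₂ one = ≤-trans (≤-reflexive (sym one)) (m≤n+m (indeg₀ v) _)
    ... | inj₁ none = ≤-reflexive (cong₂ _+_ isolatedPeak (sym none))
      where
      isolatedPeak : 1 ≡ bit (isPk G zero)
      isolatedPeak = cong (λ p → bit ((p <ᵇ 1) ∧ true)) (sym (trans predV-zero (pred₀-none none)))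

  reaches : ∀ {n} → Digraph n → Fin n → Fin n → Bool
  reaches {n} w j e = anyB (upTo n) λ t → sameTarget (walk w t (just j)) (just e)

  reaches⁻ : ∀ {n} (w : Digraph n) j e → reaches w j e ≡ true → ∃ λ t → walk w t (just j) ≡ just e
  reaches⁻ {n} w j e r with anyB⁻ (upTo n) _ r
  ... | t , _ , eq = t , sameTarget-just⁻ _ e eq

  reaches⁺ : ∀ {n} (w : Digraph n) j e t → t < n → walk w t (just j) ≡ just e → reaches w j e ≡ true
  reaches⁺ w j e t t<n eq = anyB⁺ _ (∈-upTo⁺ t<n) (sameTarget-just⁺ eq)

  module FromSource {n : ℕ} (w : Digraph n) (inj : IsPartialInjection w) {j : Fin n} (source : Source w j) where

    notOnCycle : ¬ OnCycle w j
    notOnCycle (suc p , _ , _ , period) with bind-just (walk w p (just j)) (trans (sym (walk-suc w p _)) period)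
    ... | d , _ , wd = source d wd

    walk-ends : walk w n (just j) ≡ nothing
    walk-ends with walk w n (just j) in wn
    ... | nothing = refl
    ... | just _ = contradiction (walk-defined⇒onCycle w inj j (λ stop → contradiction (trans (sym wn) stop) λ ())) notOnCycle

    walk-bound : ∀ t {c} → walk w t (just j) ≡ just c → t < n
    walk-bound t wt with <-cmp t n
    ... | tri< t<n _ _ = t<n
    ... | tri≈ _ refl _ = contradiction (trans (sym wt) walk-ends) λ ()
    ... | tri> _ _ t>n = contradiction (trans (sym wt) (walk-stopped w _ walk-ends (<⇒≤ t>n))) λ ()

    sinks-equal : ∀ t t′ {e e′} → walk w t (just j) ≡ just e → lookup w e ≡ nothing →
                  walk w t′ (just j) ≡ just e′ → lookup w e′ ≡ nothing → e ≡ e′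
    sinks-equal t t′ wt sink wt′ sink′ with <-cmp t t′
    ... | tri≈ _ refl _ = just-injective (trans (sym wt) wt′)
    ... | tri< t<t′ _ _ = contradiction (trans (sym wt′) (walk-stopped w _ (walk-past-sink w t wt sink) t<t′)) λ ()
    ... | tri> _ _ t>t′ = contradiction (trans (sym wt) (walk-stopped w _ (walk-past-sink w t′ wt′ sink′) t>t′)) λ ()

    uniqueReachableSink : countFin n (λ e → isNothing (lookup w e) ∧ reaches w j e) ≡ 1
    uniqueReachableSink with walk-lastVertex w j n walk-ends
    ... | t , e , wt , sink = countFin-unique n e (cong₂ _∧_ (cong isNothing sink) (reaches⁺ w j e t (walk-bound t wt) wt))
          λ e′ hit → let t′ , wt′ = reaches⁻ w j e′ (∧-conicalʳ _ _ hit)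
                     in sym (sinks-equal t t′ wt sink wt′ (isNothing⁻ (∧-conicalˡ _ _ hit)))

  onCycle-isolated : ∀ {n} (v : Vec (Maybe (Fin (suc n))) n) → onCycle (nothing ∷ v) zero ≡ false
  onCycle-isolated v = ¬-not λ on → neverReturns (onCycle⁻ (nothing ∷ v) zero on)
    where
    neverReturns : ¬ OnCycle (nothing ∷ v) zero
    neverReturns (suc t , _ , _ , period) = contradiction (trans (sym period) (walk-nothing _ t)) λ ()

  onCycle-loop : ∀ {n} (v : Vec (Maybe (Fin (suc n))) n) → onCycle (just zero ∷ v) zero ≡ true
  onCycle-loop v = onCycle⁺ (just zero ∷ v) zero (1 , s≤s z≤n , s≤s z≤n , refl)

  module CycleThrough₀ {n : ℕ} (j : Fin n) (v : Vec (Maybe (Fin (suc n))) n) (inj : IsPartialInjection (just (suc j) ∷ v)) where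
    open Deletion (just (suc j)) v

    ClosesCycle : Set
    ClosesCycle = ∃ λ t → ∃ λ c → walk w t (just j) ≡ just c × lookup v c ≡ just zero

    open FromSource w (injective-lower v (injective-tail inj)) (source-of-head inj refl) public using (walk-bound)

    closes⁻ : OnCycle G zero → ClosesCycle
    closes⁻ (suc t , _ , _ , period) with walk-lower j t
    ... | inj₂ (t′ , _ , _ , c , wc , vc) = t′ , c , wc , vc
    ... | inj₁ mirror with liftᵗ≡just⁻ (walk w t (just j)) (trans (sym mirror) period)
    ... | _ , () , _

    closes⁺ : ClosesCycle → OnCycle G zero
    closes⁺ (t , c , wt , vc) with walk-lower j t
    ... | inj₁ mirror = suc (suc t) , s≤s z≤n , s≤s (walk-bound t wt) ,
          trans (walk-suc G t _) (trans (cong (_>>= lookup G) (trans mirror (cong liftᵗ wt))) vc)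
    ... | inj₂ (t′ , t′<t , hits0 , _) = suc (suc t′) , s≤s z≤n , s≤s (<-trans t′<t (walk-bound t wt)) , hits0

  onCycle-prepend : ∀ {n} j (w : Digraph n) → IsPartialInjection (just (suc j) ∷ lift w) → onCycle (just (suc j) ∷ lift w) zero ≡ false
  onCycle-prepend j w inj = ¬-not λ on → noEdgeInto₀ (CycleThrough₀.closes⁻ j (lift w) inj (onCycle⁻ _ zero on))
    where
    noEdgeInto₀ : ¬ CycleThrough₀.ClosesCycle j (lift w) inj
    noEdgeInto₀ (_ , c , _ , into₀) with liftᵗ≡just⁻ (lookup w c) (trans (sym (lookup-lift w c)) into₀)
    ... | _ , () , _

  onCycle-valley : ∀ {n} j (w : Digraph n) e → lookup w e ≡ nothing → IsPartialInjection (just (suc j) ∷ lift⁺ w e) →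
                   onCycle (just (suc j) ∷ lift⁺ w e) zero ≡ reaches w j e
  onCycle-valley {n} j w e sink inj = true⇔true⇒≡ to from
    where
    open Deletion (just (suc j)) (lift⁺ w e) using (G)
    open CycleThrough₀ j (lift⁺ w e) inj
    lowered : lower (lift⁺ w e) ≡ w
    lowered = lower-lift⁺ w e sink
    to : onCycle G zero ≡ true → reaches w j e ≡ true
    to on with closes⁻ (onCycle⁻ G zero on)
    ... | t , c , wt , into₀ with lookup-lift⁺⁻ w e c into₀
    ... | inj₂ (_ , () , _)
    ... | inj₁ (refl , _) = reaches⁺ w j e t (walk-bound t wt) (subst (λ u → walk u t (just j) ≡ just e) lowered wt)
    from : reaches w j e ≡ true → onCycle G zero ≡ true
    from r with reaches⁻ w j e r
    ... | t , wt = onCycle⁺ G zero (closes⁺ (t , e , subst (λ u → walk u t (just j) ≡ just e) (sym lowered) wt , lookup-lift⁺-self w e))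

module Sums {c ℓ : Level} (R : CommutativeRing c ℓ) where
  open CommutativeRing R hiding (zero)
  open Poly R
  open import Algebra.Properties.Semiring.Sum semiring public using (sum; sum-syntax; sum-cong-≋; ∑-distrib-+; sum-replicate-zero)
  open import Algebra.Properties.CommutativeSemigroup +-commutativeSemigroup using (interchange; xy∙z≈x∙zy)
  open import Relation.Binary.Reasoning.Setoid setoid

  sumOver : ∀ {A : Set} → List A → (A → Carrier) → Carrier
  sumOver xs f = sumR (map f xs)

  sumOver-cong : ∀ {A : Set} (xs : List A) {f g : A → Carrier} → (∀ x → f x ≈ g x) → sumOver xs f ≈ sumOver xs g
  sumOver-cong [] eq = refl
  sumOver-cong (x ∷ xs) eq = +-cong (eq x) (sumOver-cong xs eq)

  sumOver-zero : ∀ {A : Set} (xs : List A) {f : A → Carrier} → (∀ x → f x ≈ 0#) → sumOver xs f ≈ 0#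
  sumOver-zero [] vanish = refl
  sumOver-zero (x ∷ xs) vanish = trans (+-cong (vanish x) (sumOver-zero xs vanish)) (+-identityˡ 0#)

  sumOver-+ : ∀ {A : Set} (xs : List A) (f g : A → Carrier) → sumOver xs (λ x → f x + g x) ≈ sumOver xs f + sumOver xs g
  sumOver-+ [] f g = sym (+-identityˡ 0#)
  sumOver-+ (x ∷ xs) f g = trans (+-cong refl (sumOver-+ xs f g)) (interchange (f x) (g x) _ _)

  sumOver-* : ∀ {A : Set} (xs : List A) a (f : A → Carrier) → sumOver xs (λ x → a * f x) ≈ a * sumOver xs f
  sumOver-* [] a f = sym (zeroʳ a)
  sumOver-* (x ∷ xs) a f = trans (+-cong refl (sumOver-* xs a f)) (sym (distribˡ a _ _))

  sumOver-comm : ∀ {A B : Set} (xs : List A) (ys : List B) (f : A → B → Carrier) →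
                 sumOver xs (λ x → sumOver ys (f x)) ≈ sumOver ys (λ y → sumOver xs (λ x → f x y))
  sumOver-comm [] ys f = sym (sumOver-zero ys λ _ → refl)
  sumOver-comm (x ∷ xs) ys f = trans (+-cong refl (sumOver-comm xs ys f)) (sym (sumOver-+ ys (f x) _))

  sumOver-++ : ∀ {A : Set} (xs ys : List A) f → sumOver (xs ++ ys) f ≈ sumOver xs f + sumOver ys f
  sumOver-++ [] ys f = sym (+-identityˡ _)
  sumOver-++ (x ∷ xs) ys f = trans (+-cong refl (sumOver-++ xs ys f)) (sym (+-assoc _ _ _))

  sumOver-map : ∀ {A B : Set} (xs : List A) (g : A → B) f → sumOver (map g xs) f ≡ sumOver xs (f ∘ g)
  sumOver-map [] g f = ≡.refl
  sumOver-map (x ∷ xs) g f = ≡.cong (f (g x) +_) (sumOver-map xs g f)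

  sumOver-tabulate : ∀ {A : Set} n (g : Fin n → A) f → sumOver (tabulate g) f ≡ ∑[ i < n ] f (g i)
  sumOver-tabulate zero g f = ≡.refl
  sumOver-tabulate (suc n) g f = ≡.cong (f (g zero) +_) (sumOver-tabulate n (g ∘ suc) f)

  sumOver-allVecs : ∀ {A : Set} (xs : List A) m f →
                    sumOver (allVecs xs (suc m)) f ≈ sumOver xs (λ x → sumOver (allVecs xs m) (f ∘ (x ∷_)))
  sumOver-allVecs xs m f = concat xs
    where
    concat : ∀ ys → sumOver (concatMap (λ x → map (x ∷_) (allVecs xs m)) ys) f ≈
                    sumOver ys (λ x → sumOver (allVecs xs m) (f ∘ (x ∷_)))
    concat [] = refl
    concat (y ∷ ys) = trans (sumOver-++ (map (y ∷_) (allVecs xs m)) _ f)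
                            (+-cong (reflexive (sumOver-map (allVecs xs m) (y ∷_) f)) (concat ys))

  targets : (n : ℕ) → List (Maybe (Fin n))
  targets n = nothing ∷ map just (allFin n)

  sumOver-targets : ∀ n h → sumOver (targets n) h ≈ h nothing + ∑[ j < n ] h (just j)
  sumOver-targets n h = +-cong refl (reflexive (≡.trans (sumOver-map (allFin n) just h) (sumOver-tabulate n (λ i → i) (h ∘ just))))

  sum-indicator : ∀ n (p : Fin n → Bool) X → ∑[ i < n ] (if p i then X else 0#) ≈ nat (countFin n p) * X
  sum-indicator zero p X = sym (zeroˡ X)
  sum-indicator (suc n) p X with p zero
  ... | true = trans (+-cong (sym (*-identityˡ X)) (sum-indicator n (p ∘ suc) X)) (sym (distribʳ X 1# _))
  ... | false = trans (+-identityˡ _) (sum-indicator n (p ∘ suc) X)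

  if-cong : ∀ b {X Y} → (b ≡ true → X ≈ Y) → (if b then X else 0#) ≈ (if b then Y else 0#)
  if-cong true X≈Y = X≈Y ≡.refl
  if-cong false _ = refl

  if-zero : ∀ b {X} → (b ≡ true → X ≈ 0#) → (if b then X else 0#) ≈ 0#
  if-zero true X≈0 = X≈0 ≡.refl
  if-zero false _ = refl

  sumOverLifts : ∀ {n m} → (Vec (Maybe (Fin (suc n))) m → Carrier) → Vec (Maybe (Fin n)) m → Carrier
  sumOverLifts {m = m} f w = f (lift w) + ∑[ e < m ] (if isNothing (lookup w e) then f (lift⁺ w e) else 0#)

  sumVecs-lift : ∀ n m (f : Vec (Maybe (Fin (suc n))) m → Carrier) → (∀ v → 1 ≤ indeg₀ v → f v ≈ 0#) →
                 sumOver (allVecs (targets (suc n)) m) f ≈ sumOver (allVecs (targets n) m) (f ∘ lift)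
  sumVecs-lift n zero f vanish = refl
  sumVecs-lift n (suc m) f vanish = begin
    sumOver (allVecs (targets (suc n)) (suc m)) f
      ≈⟨ sumOver-allVecs (targets (suc n)) m f ⟩
    sumOver (targets (suc n)) (λ a → sumOver V (f ∘ (a ∷_)))
      ≈⟨ sumOver-targets (suc n) _ ⟩
    sumOver V (f ∘ (nothing ∷_)) + (sumOver V (f ∘ (just zero ∷_)) + ∑[ j < n ] sumOver V (f ∘ (just (suc j) ∷_)))
      ≈⟨ +-cong (sumVecs-lift n m _ (vanish ∘ (nothing ∷_)))
                (trans (+-cong (sumOver-zero V (λ v → vanish (just zero ∷ v) (s≤s z≤n))) refl) (+-identityˡ _)) ⟩
    sumOver W (λ w → f (nothing ∷ lift w)) + ∑[ j < n ] sumOver V (f ∘ (just (suc j) ∷_))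
      ≈⟨ +-cong refl (sum-cong-≋ λ j → sumVecs-lift n m _ (vanish ∘ (just (suc j) ∷_))) ⟩
    sumOver W (λ w → f (nothing ∷ lift w)) + ∑[ j < n ] sumOver W (λ w → f (just (suc j) ∷ lift w))
      ≈⟨ sym (sumOver-targets n _) ⟩
    sumOver (targets n) (λ b → sumOver W (λ w → f (liftᵗ b ∷ lift w)))
      ≈⟨ sym (sumOver-allVecs (targets n) m _) ⟩
    sumOver (allVecs (targets n) (suc m)) (f ∘ lift) ∎
    where
    V = allVecs (targets (suc n)) m
    W = allVecs (targets n) m

  sumVecs-lift⁺ : ∀ n m (f : Vec (Maybe (Fin (suc n))) m → Carrier) → (∀ v → 2 ≤ indeg₀ v → f v ≈ 0#) →
                  sumOver (allVecs (targets (suc n)) m) f ≈ sumOver (allVecs (targets n) m) (sumOverLifts f)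
  sumVecs-lift⁺ n zero f vanish = sym (+-identityʳ _)
  sumVecs-lift⁺ n (suc m) f vanish = begin
    sumOver (allVecs (targets (suc n)) (suc m)) f
      ≈⟨ sumOver-allVecs (targets (suc n)) m f ⟩
    sumOver (targets (suc n)) (λ a → sumOver V (f ∘ (a ∷_)))
      ≈⟨ sumOver-targets (suc n) _ ⟩
    sumOver V (f ∘ (nothing ∷_)) + (sumOver V (f ∘ (just zero ∷_)) + ∑[ j < n ] sumOver V (f ∘ (just (suc j) ∷_)))
      ≈⟨ +-cong (sumVecs-lift⁺ n m _ (vanish ∘ (nothing ∷_)))
                (+-cong (sumVecs-lift n m _ (λ v → vanish (just zero ∷ v) ∘ s≤s))
                        (sum-cong-≋ λ j → sumVecs-lift⁺ n m _ (vanish ∘ (just (suc j) ∷_)))) ⟩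
    sumOver W (sumOverLifts (f ∘ (nothing ∷_))) +
      (sumOver W (λ w → f (just zero ∷ lift w)) + ∑[ j < n ] sumOver W (sumOverLifts (f ∘ (just (suc j) ∷_))))
      ≈⟨ trans (sym (+-assoc _ _ _))
               (+-cong (sym (sumOver-+ W _ _)) (sum-cong-≋ {n} λ j → sumOver-cong W λ w → +-cong refl (sym (+-identityˡ _)))) ⟩
    sumOver W (λ w → sumOverLifts (f ∘ (nothing ∷_)) w + f (just zero ∷ lift w)) + ∑[ j < n ] sumOver W (sumOverLifts f ∘ (just j ∷_))
      ≈⟨ +-cong (sumOver-cong W λ w → xy∙z≈x∙zy _ _ _) refl ⟩
    sumOver W (sumOverLifts f ∘ (nothing ∷_)) + ∑[ j < n ] sumOver W (sumOverLifts f ∘ (just j ∷_))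
      ≈⟨ sym (sumOver-targets n _) ⟩
    sumOver (targets n) (λ b → sumOver W (sumOverLifts f ∘ (b ∷_)))
      ≈⟨ sym (sumOver-allVecs (targets n) m _) ⟩
    sumOver (allVecs (targets n) (suc m)) (sumOverLifts f) ∎
    where
    V = allVecs (targets (suc n)) m
    W = allVecs (targets n) m

module Enumeration {c ℓ : Level} (R : CommutativeRing c ℓ) (u₁ u₂ u₃ u₄ α β : CommutativeRing.Carrier R) where
  open CommutativeRing R hiding (zero)
  open Poly R
  open Sums R
  open import Algebra.Properties.CommutativeSemigroup *-commutativeSemigroup using () renaming (interchange to *-interchange)
  open import Relation.Binary.Reasoning.Setoid setoid
  open import Tactic.RingSolver.NonReflective (fromCommutativeRing R (λ _ → nothing)) using (solve; _⊜_; _⊕_)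

  gₖ bₖ : ℕ → Carrier
  gₖ = g u₁ u₂ u₃ u₄ α β
  bₖ = b u₁ u₂ u₃ u₄ α β

  wt : ℕ → ∀ {n} → Digraph n → Carrier
  wt = weight u₁ u₂ u₃ u₄ α β

  term : ℕ → ∀ {n} → Digraph n → Carrier
  term k {n} G = if inLD n k G then wt k G else 0#

  monomial : ℕ → ℕ → ℕ → ℕ → ℕ → ℕ → Carrier
  monomial a₁ a₂ a₃ a₄ a₅ a₆ = pow u₁ a₁ * pow u₂ a₂ * pow u₃ a₃ * pow u₄ a₄ * pow α a₅ * pow β a₆

  pow-+ : ∀ x a b → pow x (a ℕ.+ b) ≈ pow x a * pow x b
  pow-+ x zero b = sym (*-identityˡ _)
  pow-+ x (suc a) b = trans (*-cong refl (pow-+ x a b)) (sym (*-assoc _ _ _))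

  monomial-+ : ∀ a₁ a₂ a₃ a₄ a₅ a₆ b₁ b₂ b₃ b₄ b₅ b₆ →
               monomial (a₁ ℕ.+ b₁) (a₂ ℕ.+ b₂) (a₃ ℕ.+ b₃) (a₄ ℕ.+ b₄) (a₅ ℕ.+ b₅) (a₆ ℕ.+ b₆) ≈
               monomial a₁ a₂ a₃ a₄ a₅ a₆ * monomial b₁ b₂ b₃ b₄ b₅ b₆
  monomial-+ a₁ a₂ a₃ a₄ a₅ a₆ b₁ b₂ b₃ b₄ b₅ b₆ =
    extend (extend (extend (extend (extend (pow-+ u₁ a₁ b₁) (pow-+ u₂ a₂ b₂)) (pow-+ u₃ a₃ b₃)) (pow-+ u₄ a₄ b₄))
      (pow-+ α a₅ b₅)) (pow-+ β a₆ b₆)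
    where
    extend : ∀ {p X Y q s t} → p ≈ X * Y → q ≈ s * t → p * q ≈ (X * s) * (Y * t)
    extend {X = X} {Y} {s = s} {t} p≈ q≈ = trans (*-cong p≈ q≈) (*-interchange X Y s t)

  module ⋆ = CommutativeMonoidSolver *-commutativeMonoid
  open ⋆ using (var) renaming (id to ε)

  infixl 7 _⊛_
  _⊛_ : ∀ {k} → ⋆.Expr k → ⋆.Expr k → ⋆.Expr k
  _⊛_ = ⋆._⊕_

  monomial-u₃ : monomial 0 0 1 0 0 0 ≈ u₃
  monomial-u₃ = ⋆.prove 1 (ε ⊛ ε ⊛ (var 0F ⊛ ε) ⊛ ε ⊛ ε ⊛ ε) (var 0F) (u₃ ∷ [])

  monomial-u₄ : monomial 0 0 0 1 0 0 ≈ u₄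
  monomial-u₄ = ⋆.prove 1 (ε ⊛ ε ⊛ ε ⊛ (var 0F ⊛ ε) ⊛ ε ⊛ ε) (var 0F) (u₄ ∷ [])

  monomial-αβ : monomial 0 0 0 0 1 1 ≈ α * β
  monomial-αβ = ⋆.prove 2 (ε ⊛ ε ⊛ ε ⊛ ε ⊛ (var 0F ⊛ ε) ⊛ (var 1F ⊛ ε)) (var 0F ⊛ var 1F) (α ∷ β ∷ [])

  monomial-u₁u₂ : ∀ r → monomial 1 1 0 0 0 r ≈ pow β r * (u₁ * u₂)
  monomial-u₁u₂ r =
    ⋆.prove 3 ((var 0F ⊛ ε) ⊛ (var 1F ⊛ ε) ⊛ ε ⊛ ε ⊛ ε ⊛ var 2F) (var 2F ⊛ (var 0F ⊛ var 1F)) (u₁ ∷ u₂ ∷ pow β r ∷ [])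

  δ : ℕ → ℕ → Carrier → Carrier
  δ a b X = if a ≡ᵇ b then X else 0#

  δ-cong : ∀ a b {X Y} → (a ≡ b → X ≈ Y) → δ a b X ≈ δ a b Y
  δ-cong a b X≈Y with a ≡ᵇ b in eq
  ... | true = X≈Y (ℕₚ.≡ᵇ⇒≡ a b (≡true⇒T eq))
  ... | false = refl

  *-δ : ∀ a b k X → k * δ a b X ≈ δ a b (k * X)
  *-δ a b k X with a ≡ᵇ b
  ... | true = refl
  ... | false = zeroʳ k

  δ-+ : ∀ a b X Y → δ a b X + δ a b Y ≈ δ a b (X + Y)
  δ-+ a b X Y with a ≡ᵇ b
  ... | true = refl
  ... | false = +-identityˡ 0#

  term-Laguerre : ∀ {n} k (G : Digraph n) → IsPartialInjection G → term k G ≡ δ (paths G) k (wt k G)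
  term-Laguerre k G inj = ≡.cong (λ l → if l ∧ (paths G ≡ᵇ k) then wt k G else 0#) (injective⇒isLaguerre G inj)

  term-nonLaguerre : ∀ {n} k (G : Digraph n) → ¬ IsPartialInjection G → term k G ≡ 0#
  term-nonLaguerre k G ¬inj = ≡.cong (λ l → if l ∧ (paths G ≡ᵇ k) then wt k G else 0#) (¬injective⇒¬isLaguerre G ¬inj)

  monomial-≡ : ∀ {a₁ a₂ a₃ a₄ a₅ a₆ b₁ b₂ b₃ b₄ b₅ b₆} →
               a₁ ≡ b₁ → a₂ ≡ b₂ → a₃ ≡ b₃ → a₄ ≡ b₄ → a₅ ≡ b₅ → a₆ ≡ b₆ →
               monomial a₁ a₂ a₃ a₄ a₅ a₆ ≡ monomial b₁ b₂ b₃ b₄ b₅ b₆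
  monomial-≡ ≡.refl ≡.refl ≡.refl ≡.refl ≡.refl ≡.refl = ≡.refl

  weight-cons : ∀ {n} (x : Maybe (Fin (suc n))) (v : Vec (Maybe (Fin (suc n))) n) {w} k {p c} →
                IsPartialInjection (x ∷ v) → lower v ≡ w → predV (x ∷ v) zero ≡ p → onCycle (x ∷ v) zero ≡ c →
                wt k (x ∷ v) ≡ monomial (bit ((p <ᵇ 1) ∧ (lab x <ᵇ 1)) ℕ.+ pk w ∸ k) (bit ((1 <ᵇ p) ∧ (1 <ᵇ lab x)) ℕ.+ val w)
                                        (bit ((p <ᵇ 1) ∧ (1 <ᵇ lab x)) ℕ.+ da w) (bit ((1 <ᵇ p) ∧ (lab x <ᵇ 1)) ℕ.+ dd w)
                                        (bit ((p ≡ᵇ 1) ∧ (lab x ≡ᵇ 1)) ℕ.+ fp w) (bit c ℕ.+ cyc w)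
  weight-cons x v k inj ≡.refl ≡.refl ≡.refl =
    monomial-≡ (≡.cong (_∸ k) (pk-cons inj)) (val-cons inj) (da-cons inj) (dd-cons inj) (fp-cons inj) (cyc-cons inj)
    where open Deletion x v

  recurrence : (ℕ → Carrier) → ℕ → Carrier
  recurrence f zero = gₖ 0 * f 0 + bₖ 1 * f 1
  recurrence f (suc k) = f k + gₖ (suc k) * f (suc k) + bₖ (suc (suc k)) * f (suc (suc k))

  μ-suc : ∀ n k → μ u₁ u₂ u₃ u₄ α β (suc n) k ≡ recurrence (μ u₁ u₂ u₃ u₄ α β n) k
  μ-suc n zero = ≡.refl
  μ-suc n (suc k) = ≡.refl

  recurrence-cong : ∀ {f f′} → (∀ j → f j ≈ f′ j) → ∀ k → recurrence f k ≈ recurrence f′ k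
  recurrence-cong f≈ zero = +-cong (*-cong refl (f≈ 0)) (*-cong refl (f≈ 1))
  recurrence-cong f≈ (suc k) = +-cong (+-cong (f≈ k) (*-cong refl (f≈ (suc k)))) (*-cong refl (f≈ (suc (suc k))))

  recurrence-zero : ∀ {f} → (∀ j → f j ≈ 0#) → ∀ k → recurrence f k ≈ 0#
  recurrence-zero f≈0 zero = trans (+-cong (trans (*-cong refl (f≈0 0)) (zeroʳ _)) (trans (*-cong refl (f≈0 1)) (zeroʳ _))) (+-identityˡ 0#)
  recurrence-zero f≈0 (suc k) =
    trans (+-cong (+-cong (f≈0 k) (trans (*-cong refl (f≈0 (suc k))) (zeroʳ _))) (trans (*-cong refl (f≈0 (suc (suc k)))) (zeroʳ _)))
          (trans (+-identityʳ _) (+-identityˡ 0#))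

  recurrence-sumOver : ∀ {A : Set} (xs : List A) (f : ℕ → A → Carrier) k →
                       sumOver xs (λ x → recurrence (λ j → f j x) k) ≈ recurrence (λ j → sumOver xs (f j)) k
  recurrence-sumOver xs f zero = trans (sumOver-+ xs _ _) (+-cong (sumOver-* xs _ (f 0)) (sumOver-* xs _ (f 1)))
  recurrence-sumOver xs f (suc k) = trans (sumOver-+ xs _ _)
    (+-cong (trans (sumOver-+ xs _ _) (+-cong refl (sumOver-* xs _ (f (suc k))))) (sumOver-* xs _ (f (suc (suc k)))))

  δ-sum : ∀ {n} a b (p : Fin n → Bool) (Y : Fin n → Carrier) →
          ∑[ e < n ] (if p e then δ a b (Y e) else 0#) ≈ δ a b (∑[ e < n ] (if p e then Y e else 0#))
  δ-sum {n} a b p Y with a ≡ᵇ b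
  ... | true = refl
  ... | false = trans (sum-cong-≋ λ e → if-zero (p e) λ _ → refl) (sum-replicate-zero n)

  module Insertions {n : ℕ} (w : Digraph n) (injw : IsPartialInjection w) where

    h : ℕ
    h = paths w

    W : Carrier
    W = wt h w

    paths-lift : ∀ x → paths (x ∷ lift w) ≡ bit (isNothing x) ℕ.+ h
    paths-lift x = ≡.trans (≡.sym (ℕₚ.+-identityʳ _)) (≡.trans (≡.cong (paths (x ∷ lift w) ℕ.+_) (≡.sym (indeg₀-lift w)))
                   (≡.trans (Deletion.paths-cons x (lift w)) (≡.cong (λ u → bit (isNothing x) ℕ.+ paths u) (lower-lift w))))

    paths-lift⁺ : ∀ x e → lookup w e ≡ nothing → suc (paths (x ∷ lift⁺ w e)) ≡ bit (isNothing x) ℕ.+ h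
    paths-lift⁺ x e sink = ≡.trans (ℕₚ.+-comm 1 _) (≡.trans (≡.cong (paths (x ∷ lift⁺ w e) ℕ.+_) (≡.sym (indeg₀-lift⁺ w e)))
                   (≡.trans (Deletion.paths-cons x (lift⁺ w e)) (≡.cong (λ u → bit (isNothing x) ℕ.+ paths u) (lower-lift⁺ w e sink))))

    predV-lift : ∀ x → predV (x ∷ lift w) zero ≡ (if pointsTo₀ x then 1 else 0)
    predV-lift x = ≡.trans predV-zero (≡.cong (if_then_else_ (pointsTo₀ x) 1) (pred₀-none (indeg₀-lift w)))
      where open Deletion x (lift w) using (predV-zero; pred₀-none)

    predV-lift⁺ : ∀ x e → ∃ λ m → predV (x ∷ lift⁺ w e) zero ≡ (if pointsTo₀ x then 1 else suc (suc m))
    predV-lift⁺ x e with Deletion.pred₀-some x (lift⁺ w e) (ℕₚ.≤-reflexive (≡.sym (indeg₀-lift⁺ w e)))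
    ... | m , eq = m , ≡.trans (Deletion.predV-zero x (lift⁺ w e)) (≡.cong (if_then_else_ (pointsTo₀ x) 1) eq)

    isolated : ∀ k → term k (nothing ∷ lift w) ≈ δ (suc h) k W
    isolated k = begin
      term k G                ≡⟨ term-Laguerre k G injG ⟩
      δ (paths G) k (wt k G)  ≡⟨ ≡.cong (λ p → δ p k (wt k G)) (paths-lift nothing) ⟩
      δ (suc h) k (wt k G)    ≈⟨ δ-cong (suc h) k (λ { ≡.refl → reflexive weightG }) ⟩
      δ (suc h) k W           ∎
      where
      G = nothing ∷ lift w
      injG : IsPartialInjection G
      injG = injective-cons (λ _ ()) (injective-lift w injw)
      weightG : wt (suc h) G ≡ W
      weightG = weight-cons nothing (lift w) (suc h) injG (lower-lift w) (predV-lift nothing) (onCycle-isolated (lift w))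

    appendToSink : ∀ e → lookup w e ≡ nothing → ∀ k → term k (nothing ∷ lift⁺ w e) ≈ δ h k (u₄ * W)
    appendToSink e sink k with predV-lift⁺ nothing e
    ... | _ , predV≡ = begin
      term k G                ≡⟨ term-Laguerre k G injG ⟩
      δ (paths G) k (wt k G)  ≡⟨ ≡.cong (λ p → δ p k (wt k G)) (ℕₚ.suc-injective (paths-lift⁺ nothing e sink)) ⟩
      δ h k (wt k G)          ≈⟨ δ-cong h k (λ { ≡.refl → weightG }) ⟩
      δ h k (u₄ * W)          ∎
      where
      G = nothing ∷ lift⁺ w e
      injG : IsPartialInjection G
      injG = injective-cons (λ _ ()) (injective-lift⁺ w e injw)
      weightG : wt h G ≈ u₄ * W
      weightG = trans (reflexive (weight-cons nothing (lift⁺ w e) h injG (lower-lift⁺ w e sink) predV≡ (onCycle-isolated (lift⁺ w e))))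
                     (trans (monomial-+ 0 0 0 1 0 0 (pk w ∸ h) (val w) (da w) (dd w) (fp w) (cyc w)) (*-cong monomial-u₄ refl))

    loop : ∀ k → term k (just zero ∷ lift w) ≈ δ h k (α * β * W)
    loop k = begin
      term k G                ≡⟨ term-Laguerre k G injG ⟩
      δ (paths G) k (wt k G)  ≡⟨ ≡.cong (λ p → δ p k (wt k G)) (paths-lift (just zero)) ⟩
      δ h k (wt k G)          ≈⟨ δ-cong h k (λ { ≡.refl → weightG }) ⟩
      δ h k (α * β * W)       ∎
      where
      G = just zero ∷ lift w
      injG : IsPartialInjection G
      injG = injective-cons (λ { i ≡.refl → lift-noEdgeInto₀ w i }) (injective-lift w injw)
      weightG : wt h G ≈ α * β * W
      weightG = trans (reflexive (weight-cons (just zero) (lift w) h injG (lower-lift w) (predV-lift (just zero)) (onCycle-loop (lift w))))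
                     (trans (monomial-+ 0 0 0 0 1 1 (pk w ∸ h) (val w) (da w) (dd w) (fp w) (cyc w)) (*-cong monomial-αβ refl))

    prependToSource : ∀ j → Source w j → ∀ k → term k (just (suc j) ∷ lift w) ≈ δ h k (u₃ * W)
    prependToSource j source k = begin
      term k G                ≡⟨ term-Laguerre k G injG ⟩
      δ (paths G) k (wt k G)  ≡⟨ ≡.cong (λ p → δ p k (wt k G)) (paths-lift (just (suc j))) ⟩
      δ h k (wt k G)          ≈⟨ δ-cong h k (λ { ≡.refl → weightG }) ⟩
      δ h k (u₃ * W)          ∎
      where
      G = just (suc j) ∷ lift w
      injG : IsPartialInjection G
      injG = injective-prepend (lower-lift w) (injective-lift w injw) source
      weightG : wt h G ≈ u₃ * W
      weightG = trans (reflexive (weight-cons (just (suc j)) (lift w) h injG (lower-lift w) (predV-lift (just (suc j))) (onCycle-prepend j w injG)))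
                     (trans (monomial-+ 0 0 1 0 0 0 (pk w ∸ h) (val w) (da w) (dd w) (fp w) (cyc w)) (*-cong monomial-u₃ refl))

    valley : ∀ j → Source w j → ∀ e → lookup w e ≡ nothing → ∀ k →
             term k (just (suc j) ∷ lift⁺ w e) ≈ δ h (suc k) (pow β (bit (reaches w j e)) * (u₁ * u₂ * W))
    valley j source e sink k with predV-lift⁺ (just (suc j)) e
    ... | _ , predV≡ = begin
      term k G                            ≡⟨ term-Laguerre k G injG ⟩
      δ (suc (paths G)) (suc k) (wt k G)  ≡⟨ ≡.cong (λ p → δ p (suc k) (wt k G)) (paths-lift⁺ (just (suc j)) e sink) ⟩
      δ h (suc k) (wt k G)                ≈⟨ δ-cong h (suc k) weightG ⟩
      δ h (suc k) (pow β (bit r) * (u₁ * u₂ * W)) ∎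
      where
      G = just (suc j) ∷ lift⁺ w e
      r = reaches w j e
      injG : IsPartialInjection G
      injG = injective-prepend (lower-lift⁺ w e sink) (injective-lift⁺ w e injw) source
      -- pk − k is truncated subtraction; it does not truncate because paths ≤ pk.
      pk∸k : h ≡ suc k → pk w ∸ k ≡ suc (pk w ∸ h)
      pk∸k h≡1+k = ≡.trans (∸-pred (≡.subst (ℕ._≤ pk w) h≡1+k (paths≤pk w injw)))
                           (≡.cong (λ t → suc (pk w ∸ t)) (≡.sym h≡1+k))
        where
        ∸-pred : ∀ {a k} → suc k ≤ a → a ∸ k ≡ suc (a ∸ suc k)
        ∸-pred {suc a} (s≤s k≤a) = ℕₚ.+-∸-assoc 1 k≤a
      weightG : h ≡ suc k → wt k G ≈ pow β (bit r) * (u₁ * u₂ * W)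
      weightG h≡1+k = begin
        wt k G
          ≡⟨ weight-cons (just (suc j)) (lift⁺ w e) k injG (lower-lift⁺ w e sink) predV≡ (onCycle-valley j w e sink injG) ⟩
        monomial (pk w ∸ k) (suc (val w)) (da w) (dd w) (fp w) (bit r ℕ.+ cyc w)
          ≡⟨ ≡.cong (λ a → monomial a (suc (val w)) (da w) (dd w) (fp w) (bit r ℕ.+ cyc w)) (pk∸k h≡1+k) ⟩
        monomial (1 ℕ.+ (pk w ∸ h)) (1 ℕ.+ val w) (da w) (dd w) (fp w) (bit r ℕ.+ cyc w)
          ≈⟨ monomial-+ 1 1 0 0 0 (bit r) (pk w ∸ h) (val w) (da w) (dd w) (fp w) (cyc w) ⟩
        monomial 1 1 0 0 0 (bit r) * W
          ≈⟨ trans (*-cong (monomial-u₁u₂ (bit r)) refl) (*-assoc _ _ _) ⟩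
        pow β (bit r) * (u₁ * u₂ * W) ∎

    loopWithEdge : ∀ e k → term k (just zero ∷ lift⁺ w e) ≡ 0#
    loopWithEdge e k = term-nonLaguerre k (just zero ∷ lift⁺ w e) λ inj → Finₚ.0≢1+n (inj zero (suc e) ≡.refl (lookup-lift⁺-self w e))

    notFromSource : ∀ j {v} → isSource w j ≡ false → lower v ≡ w → ∀ k → term k (just (suc j) ∷ v) ≡ 0#
    notFromSource j {v} notSource lowered k = term-nonLaguerre k (just (suc j) ∷ v) λ inj →
      contradiction (≡.trans (≡.sym (isSource⁺ w j (≡.subst (λ u → Source u j) lowered (source-of-head {v = v} inj ≡.refl))))
                             notSource) λ ()

    Z : Carrier
    Z = u₁ * u₂ * W

    isSink : Fin n → Bool
    isSink e = isNothing (lookup w e)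

    -- Exactly one of the h sinks ends the path that starts at j; joining that one closes a cycle.
    valleys : ∀ j → Source w j → ∀ k →
              ∑[ e < n ] (if isSink e then δ h (suc k) (pow β (bit (reaches w j e)) * Z) else 0#) ≈ δ h (suc k) ((β + nat k) * Z)
    valleys j source k = trans (δ-sum h (suc k) isSink _) (δ-cong h (suc k) λ h≡1+k → begin
      ∑[ e < n ] (if isSink e then pow β (bit (reached e)) * Z else 0#)
        ≈⟨ sum-cong-≋ (λ e → split (isSink e) (reached e)) ⟩
      ∑[ e < n ] ((if isSink e ∧ reached e then β * Z else 0#) + (if isSink e ∧ not (reached e) then Z else 0#))
        ≈⟨ ∑-distrib-+ {n} _ _ ⟩
      ∑[ e < n ] (if isSink e ∧ reached e then β * Z else 0#) + ∑[ e < n ] (if isSink e ∧ not (reached e) then Z else 0#)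
        ≈⟨ +-cong (sum-indicator n _ _) (sum-indicator n _ _) ⟩
      nat (countFin n reachedSink) * (β * Z) + nat (countFin n otherSink) * Z
        ≡⟨ ≡.cong₂ (λ a b → nat a * (β * Z) + nat b * Z) oneReached (others h≡1+k) ⟩
      (1# + 0#) * (β * Z) + nat k * Z
        ≈⟨ +-cong (trans (*-cong (+-identityʳ 1#) refl) (*-identityˡ _)) refl ⟩
      β * Z + nat k * Z
        ≈⟨ sym (distribʳ Z β (nat k)) ⟩
      (β + nat k) * Z ∎)
      where
      reached = reaches w j
      reachedSink otherSink : Fin n → Bool
      reachedSink e = isSink e ∧ reached e
      otherSink e = isSink e ∧ not (reached e)
      split : ∀ s r → (if s then pow β (bit r) * Z else 0#) ≈ (if s ∧ r then β * Z else 0#) + (if s ∧ not r then Z else 0#)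
      split true true = trans (*-cong (*-identityʳ β) refl) (sym (+-identityʳ _))
      split true false = trans (*-identityˡ Z) (sym (+-identityˡ _))
      split false _ = sym (+-identityˡ 0#)
      oneReached : countFin n reachedSink ≡ 1
      oneReached = FromSource.uniqueReachableSink w injw source
      others : h ≡ suc k → countFin n otherSink ≡ k
      others h≡1+k = ℕₚ.suc-injective (≡.trans (≡.cong (ℕ._+ countFin n otherSink) (≡.sym oneReached))
                       (≡.trans (countFin-+ n λ e → partition (isSink e) (reached e)) (≡.trans (≡.sym (count-allFin n isSink)) h≡1+k)))
        where
        partition : ∀ s r → bit (s ∧ r) ℕ.+ bit (s ∧ not r) ≡ bit s
        partition true true = ≡.refl
        partition true false = ≡.refl
        partition false _ = ≡.refl

    fromNothing : ∀ k → sumOverLifts (term k ∘ (nothing ∷_)) w ≈ δ (suc h) k W + nat h * δ h k (u₄ * W)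
    fromNothing k = +-cong (isolated k) (begin
      ∑[ e < n ] (if isSink e then term k (nothing ∷ lift⁺ w e) else 0#)
        ≈⟨ sum-cong-≋ (λ e → if-cong (isSink e) λ s → appendToSink e (isNothing⁻ s) k) ⟩
      ∑[ e < n ] (if isSink e then δ h k (u₄ * W) else 0#)
        ≈⟨ sum-indicator n isSink _ ⟩
      nat (countFin n isSink) * δ h k (u₄ * W)
        ≡⟨ ≡.cong (λ c → nat c * δ h k (u₄ * W)) (≡.sym (count-allFin n isSink)) ⟩
      nat h * δ h k (u₄ * W) ∎)

    fromLoop : ∀ k → sumOverLifts (term k ∘ (just zero ∷_)) w ≈ δ h k (α * β * W)
    fromLoop k = trans (+-cong (loop k) (trans (sum-cong-≋ λ e → if-zero (isSink e) λ _ → reflexive (loopWithEdge e k)) (sum-replicate-zero n)))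
                       (+-identityʳ _)

    fromVertex : ∀ j k → sumOverLifts (term k ∘ (just (suc j) ∷_)) w ≈
                         (if isSource w j then δ h k (u₃ * W) + δ h (suc k) ((β + nat k) * Z) else 0#)
    fromVertex j k with isSource w j in src
    ... | true = +-cong (prependToSource j (isSource⁻ w j src) k)
                        (trans (sum-cong-≋ λ e → if-cong (isSink e) λ s → valley j (isSource⁻ w j src) e (isNothing⁻ s) k)
                               (valleys j (isSource⁻ w j src) k))
    ... | false = trans (+-cong (reflexive (notFromSource j src (lower-lift w) k))
                                (trans (sum-cong-≋ λ e → if-zero (isSink e) λ s → reflexive (notFromSource j src (lower-lift⁺ w e (isNothing⁻ s)) k))
                                       (sum-replicate-zero n)))
                        (+-identityˡ 0#)

    insertions : ∀ k → sumOver (targets (suc n)) (λ x → sumOverLifts (term k ∘ (x ∷_)) w) ≈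
                       δ (suc h) k W + (δ h k (gₖ h * W) + δ h (suc k) (bₖ h * W))
    insertions k = begin
      sumOver (targets (suc n)) (λ x → sumOverLifts (term k ∘ (x ∷_)) w)
        ≈⟨ sumOver-targets (suc n) _ ⟩
      sumOverLifts (term k ∘ (nothing ∷_)) w +
        (sumOverLifts (term k ∘ (just zero ∷_)) w + ∑[ j < n ] sumOverLifts (term k ∘ (just (suc j) ∷_)) w)
        ≈⟨ +-cong (fromNothing k) (+-cong (fromLoop k) (trans (sum-cong-≋ λ j → fromVertex j k) (sum-indicator n (isSource w) _))) ⟩
      (δ (suc h) k W + nat h * δ h k (u₄ * W)) + (δ h k (α * β * W) + nat (sources w) * (δ h k (u₃ * W) + δ h (suc k) ((β + nat k) * Z)))
        ≡⟨ ≡.cong (λ s → (δ (suc h) k W + nat h * δ h k (u₄ * W)) + (δ h k (α * β * W) + nat s * (δ h k (u₃ * W) + δ h (suc k) ((β + nat k) * Z))))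
                  (sources≡paths w injw) ⟩
      (δ (suc h) k W + nat h * δ h k (u₄ * W)) + (δ h k (α * β * W) + nat h * (δ h k (u₃ * W) + δ h (suc k) ((β + nat k) * Z)))
        ≈⟨ +-cong refl (+-cong refl (distribˡ (nat h) _ _)) ⟩
      (δ (suc h) k W + nat h * δ h k (u₄ * W)) + (δ h k (α * β * W) + (nat h * δ h k (u₃ * W) + nat h * δ h (suc k) ((β + nat k) * Z)))
        ≈⟨ regroup _ _ _ _ _ ⟩
      δ (suc h) k W + ((nat h * δ h k (u₄ * W) + δ h k (α * β * W) + nat h * δ h k (u₃ * W)) + nat h * δ h (suc k) ((β + nat k) * Z))
        ≈⟨ +-cong refl (+-cong gTerm bTerm) ⟩
      δ (suc h) k W + (δ h k (gₖ h * W) + δ h (suc k) (bₖ h * W)) ∎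
      where
      regroup : ∀ a p q r s → (a + p) + (q + (r + s)) ≈ a + ((p + q + r) + s)
      regroup = solve 5 (λ a p q r s → ((a ⊕ p) ⊕ (q ⊕ (r ⊕ s))) ⊜ (a ⊕ ((p ⊕ q ⊕ r) ⊕ s))) refl
      gTerm : nat h * δ h k (u₄ * W) + δ h k (α * β * W) + nat h * δ h k (u₃ * W) ≈ δ h k (gₖ h * W)
      gTerm = trans (+-cong (+-cong (*-δ h k _ _) refl) (*-δ h k _ _))
                (trans (+-cong (δ-+ h k _ _) refl) (trans (δ-+ h k _ _) (δ-cong h k λ _ → gₖ-expand (nat h) u₃ u₄ α β W)))
        where
        gₖ-expand : ∀ N U₃ U₄ A B X → N * (U₄ * X) + A * B * X + N * (U₃ * X) ≈ (N * (U₃ + U₄) + A * B) * X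
        gₖ-expand N U₃ U₄ A B X = sym (begin
          (N * (U₃ + U₄) + A * B) * X          ≈⟨ distribʳ X _ _ ⟩
          N * (U₃ + U₄) * X + A * B * X        ≈⟨ +-cong (trans (*-assoc N _ X) (*-cong refl (distribʳ X U₃ U₄))) refl ⟩
          N * (U₃ * X + U₄ * X) + A * B * X    ≈⟨ +-cong (distribˡ N _ _) refl ⟩
          N * (U₃ * X) + N * (U₄ * X) + A * B * X ≈⟨ solve 3 (λ p q r → ((p ⊕ q) ⊕ r) ⊜ ((q ⊕ r) ⊕ p)) refl _ _ _ ⟩
          N * (U₄ * X) + A * B * X + N * (U₃ * X) ∎)
      bTerm : nat h * δ h (suc k) ((β + nat k) * Z) ≈ δ h (suc k) (bₖ h * W)
      bTerm = trans (*-δ h (suc k) _ _) (δ-cong h (suc k) λ h≡1+k →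
                trans (bₖ-expand (nat h) (β + nat k) u₁ u₂ W)
                      (*-cong (*-cong (*-cong (*-cong refl (sym (shift (nat k) (≡.cong nat h≡1+k)))) refl) refl) refl))
        where
        bₖ-expand : ∀ N B U₁ U₂ X → N * (B * (U₁ * U₂ * X)) ≈ N * B * U₁ * U₂ * X
        bₖ-expand N B U₁ U₂ X =
          trans (sym (*-assoc N B _)) (trans (sym (*-assoc (N * B) (U₁ * U₂) X)) (*-cong (sym (*-assoc (N * B) U₁ U₂)) refl))
        shift : ∀ K {N} → N ≡ 1# + K → (β + - 1#) + N ≈ β + K
        shift K ≡.refl = trans (+-assoc β (- 1#) (1# + K))
                           (+-cong refl (trans (sym (+-assoc (- 1#) 1# K)) (trans (+-cong (-‿inverseˡ 1#) refl) (+-identityˡ K))))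

    scaledTerm : ∀ (c : ℕ → Carrier) j → c j * term j w ≈ δ h j (c h * W)
    scaledTerm c j = trans (*-cong refl (reflexive (term-Laguerre j w injw)))
      (trans (*-δ h j _ _) (δ-cong h j λ h≡j → reflexive (≡.cong (λ t → c t * wt t w) (≡.sym h≡j))))

    recurrence-terms : ∀ k → recurrence (λ j → term j w) k ≈ δ (suc h) k W + (δ h k (gₖ h * W) + δ h (suc k) (bₖ h * W))
    recurrence-terms zero = trans (+-cong (scaledTerm gₖ 0) (scaledTerm bₖ 1)) (sym (+-identityˡ _))
    recurrence-terms (suc k) = trans (+-assoc _ _ _) (+-cong plainTerm (+-cong (scaledTerm gₖ (suc k)) (scaledTerm bₖ (suc (suc k)))))
      where
      plainTerm : term k w ≈ δ h k W
      plainTerm = trans (reflexive (term-Laguerre k w injw)) (δ-cong h k λ h≡k → reflexive (≡.cong (λ t → wt t w) (≡.sym h≡k)))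

  insertions≈recurrence : ∀ {n} (w : Digraph n) k →
                          sumOver (targets (suc n)) (λ x → sumOverLifts (term k ∘ (x ∷_)) w) ≈ recurrence (λ j → term j w) k
  insertions≈recurrence {n} w k = byLaguerre (isLaguerre w) ≡.refl
    where
    byLaguerre : ∀ l → isLaguerre w ≡ l →
                 sumOver (targets (suc n)) (λ x → sumOverLifts (term k ∘ (x ∷_)) w) ≈ recurrence (λ j → term j w) k
    byLaguerre true lag = trans (insertions k) (sym (recurrence-terms k))
      where open Insertions w (isLaguerre⇒injective w lag)
    byLaguerre false lag = trans (sumOver-zero (targets (suc n)) λ x → trans
        (+-cong (reflexive (vanishes x (lift w) (lower-lift w)))
                (sum-cong-≋ λ e → if-zero (isNothing (lookup w e)) λ s → reflexive (vanishes x (lift⁺ w e) (lower-lift⁺ w e (isNothing⁻ s)))))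
        (trans (+-identityˡ _) (sum-replicate-zero n)))
      (sym (recurrence-zero (λ j → reflexive (≡.cong (λ l → if l ∧ (paths w ≡ᵇ j) then wt j w else 0#) lag)) k))
      where
      vanishes : ∀ x v → lower v ≡ w → term k (x ∷ v) ≡ 0#
      vanishes x v lowered = term-nonLaguerre k (x ∷ v) λ inj →
        contradiction (≡.trans (≡.sym (injective⇒isLaguerre w (≡.subst IsPartialInjection lowered
                                                                 (injective-lower v (injective-tail inj)))))
                               lag) λ ()

  ldSum-suc : ∀ n k → ldSum u₁ u₂ u₃ u₄ α β (suc n) k ≈ recurrence (ldSum u₁ u₂ u₃ u₄ α β n) k
  ldSum-suc n k = begin
    sumOver (allVecs (targets (suc n)) (suc n)) (term k)
      ≈⟨ sumOver-allVecs (targets (suc n)) n (term k) ⟩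
    sumOver (targets (suc n)) (λ x → sumOver (allVecs (targets (suc n)) n) (term k ∘ (x ∷_)))
      ≈⟨ sumOver-cong (targets (suc n)) (λ x → sumVecs-lift⁺ n n (term k ∘ (x ∷_)) (vanishes x)) ⟩
    sumOver (targets (suc n)) (λ x → sumOver Ws (sumOverLifts (term k ∘ (x ∷_))))
      ≈⟨ sumOver-comm (targets (suc n)) Ws _ ⟩
    sumOver Ws (λ w → sumOver (targets (suc n)) (λ x → sumOverLifts (term k ∘ (x ∷_)) w))
      ≈⟨ sumOver-cong Ws (λ w → insertions≈recurrence w k) ⟩
    sumOver Ws (λ w → recurrence (λ j → term j w) k)
      ≈⟨ recurrence-sumOver Ws (λ j → term j) k ⟩
    recurrence (λ j → sumOver Ws (term j)) k ∎
    where
    Ws = allVecs (targets n) n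
    vanishes : ∀ x v → 2 ≤ indeg₀ v → term k (x ∷ v) ≈ 0#
    vanishes x v 2≤ = reflexive (term-nonLaguerre k (x ∷ v) λ inj → contradiction (indeg₀≤1 v (injective-tail inj)) (ℕₚ.<⇒≱ 2≤))

  μ≈ldSum : ∀ n k → μ u₁ u₂ u₃ u₄ α β n k ≈ ldSum u₁ u₂ u₃ u₄ α β n k
  μ≈ldSum zero zero = sym (trans (+-identityʳ _) (⋆.prove 0 (ε ⊛ ε ⊛ ε ⊛ ε ⊛ ε ⊛ ε) ε []))
  μ≈ldSum zero (suc k) = sym (+-identityʳ 0#)
  μ≈ldSum (suc n) k = trans (reflexive (μ-suc n k)) (trans (recurrence-cong (μ≈ldSum n) k) (sym (ldSum-suc n k)))

theorem2p3 : ∀ {c ℓ} (R : CommutativeRing c ℓ)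
               (u₁ u₂ u₃ u₄ α β : CommutativeRing.Carrier R) (n k : ℕ) → k ≤ n →
               CommutativeRing._≈_ R (Poly.μ R u₁ u₂ u₃ u₄ α β n k) (Poly.ldSum R u₁ u₂ u₃ u₄ α β n k)
-- The identity holds for every k (both sides vanish for k > n).
theorem2p3 R u₁ u₂ u₃ u₄ α β n k _ = Enumeration.μ≈ldSum R u₁ u₂ u₃ u₄ α β n k
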